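{- For each integer $m\ge1$, with $F_m(s)=\sum_{j=0}^m\frac{a_{m,j}B_j}{s+j-1}$, \[ F_m(s)=\frac{1}{m+1}\,\frac{\det\big(T_m+R_m+(s-1)I_m\big)}{\prod_{j=0}^m(s+j-1)}, \] where $I_m$ is the $m\times m$ identity matrix and, with indices $1\le i,j\le m$, $T_m$ is the lower triangular matrix with $(T_m)_{jj}=j$, $(T_m)_{ij}=-\frac{j}{(i-j)(i-j+1)}$ for $i>j$ and $(T_m)_{ij}=0$ for $i<j$, and $R_m$ is the rank-one matrix $(R_m)_{ij}=\frac{(m+1)j}{i(i+1)(m-j+1)}$.
   Context: For an integer $m\ge0$, $p_m(t)=(1-t)(1-t/2)\cdots(1-t/m)$ (with $p_0\equiv1$), and the coefficients $a_{m,j}$ are defined by $p_m(t)=\sum_{j=0}^m(-1)^j a_{m,j}t^j$. The $B_j$ are the Bernoulli numbers defined by $\frac{z}{e^z-1}=\sum_{j\ge0}\frac{B_j}{j!}z^j$. -}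

module Defs where

open import Data.Nat as ℕ using (ℕ; zero; suc; _≤?_)
open import Data.Nat.Combinatorics using (_C_)
open import Data.Fin as Fin using (Fin; toℕ; punchIn)
open import Data.Integer as ℤ using (+_; +0; +[1+_]; -[1+_])
open import Data.Rational using (ℚ; mkℚ; _/_; 0ℚ; 1ℚ; 1/_; _+_; _*_; _-_; -_)
open import Relation.Nullary using (yes; no)

ℕ→ℚ : ℕ → ℚ
ℕ→ℚ n = (+ n) / 1

-- total inverse: inv 0 = 0 (only ever used at nonzero arguments)
inv : ℚ → ℚ
inv (mkℚ +0 _ _) = 0ℚ
inv p@(mkℚ +[1+ _ ] _ _) = 1/ p
inv p@(mkℚ -[1+ _ ] _ _) = 1/ p

sgn : ℕ → ℚ
sgn zero = 1ℚ
sgn (suc j) = - sgn j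

Σ : (n : ℕ) → (Fin n → ℚ) → ℚ
Σ zero f = 0ℚ
Σ (suc n) f = f Fin.zero + Σ n (λ i → f (Fin.suc i))

Π : (n : ℕ) → (Fin n → ℚ) → ℚ
Π zero f = 1ℚ
Π (suc n) f = f Fin.zero * Π n (λ i → f (Fin.suc i))

-- coefficient of t^j in p_m(t) = (1-t)(1-t/2)...(1-t/m), p_0 = 1
pcoeff : ℕ → ℕ → ℚ
pcoeff zero zero = 1ℚ
pcoeff zero (suc j) = 0ℚ
pcoeff (suc m) zero = pcoeff m zero
pcoeff (suc m) (suc j) = pcoeff m (suc j) - pcoeff m j * inv (ℕ→ℚ (suc m))

-- p_m(t) = Σ_j (-1)^j a_{m,j} t^j
a : ℕ → ℕ → ℚ
a m j = sgn j * pcoeff m j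

-- Bernoulli numbers with B_1 = -1/2 (convention of z/(e^z-1)),
-- via the equivalent recurrence Σ_{k=0}^{n} C(n+1,k) B_k = 0 (n ≥ 1), B_0 = 1.
-- bernTable n k = B_k for k ≤ n.
bernTable : ℕ → ℕ → ℚ
bernTable zero _ = 1ℚ
bernTable (suc n) k with k ℕ.≤? n
... | yes _ = bernTable n k
... | no _ = - (inv (ℕ→ℚ (suc (suc n))) *
               Σ (suc n) (λ i → ℕ→ℚ (suc (suc n) C toℕ i) * bernTable n (toℕ i)))

B : ℕ → ℚ
B n = bernTable n n

det : (n : ℕ) → (Fin n → Fin n → ℚ) → ℚ
det zero M = 1ℚ
det (suc n) M =
  Σ (suc n) (λ j → sgn (toℕ j) * M Fin.zero j *
                   det n (λ i k → M (Fin.suc i) (punchIn j k)))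

F : ℕ → ℚ → ℚ
F m s = Σ (suc m) (λ j → a m (toℕ j) * B (toℕ j) * inv (s + ℕ→ℚ (toℕ j) - 1ℚ))

idx : {m : ℕ} → Fin m → ℕ
idx i = suc (toℕ i)

T : (m : ℕ) → Fin m → Fin m → ℚ
T m i j with idx j ℕ.<? idx i | idx i ℕ.≟ idx j
... | no _ | no _ = 0ℚ
... | no _ | yes _ = ℕ→ℚ (idx j)
... | yes _ | _ =
  - (ℕ→ℚ (idx j) * inv (ℕ→ℚ ((idx i ℕ.∸ idx j) ℕ.* (idx i ℕ.∸ idx j ℕ.+ 1))))

R : (m : ℕ) → Fin m → Fin m → ℚ
R m i j = ℕ→ℚ ((m ℕ.+ 1) ℕ.* idx j) *
          inv (ℕ→ℚ (idx i ℕ.* (idx i ℕ.+ 1) ℕ.* (m ℕ.∸ idx j ℕ.+ 1)))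

I : (m : ℕ) → Fin m → Fin m → ℚ
I m i j with i Fin.≟ j
... | yes _ = 1ℚ
... | no _ = 0ℚ

{-# OPTIONS --safe #-}
-- Write q_m(x) = Π_{j=1}^m (1 + x/j) = Σ_k a m k xᵏ. The Bernoulli recurrence Σ_k C(n,k) B_k = B_n + [n = 1],
-- combined with (1 + x) q_m(1 + x) = (m + 1) q_{m+1}(x), gives Σ_k a m k B_k = 1/(m + 1); together with
-- q_n′ = Σ_{t<n} q_t/(n - t) this yields the convolution identity
--   (s - 1) F_n(s) = 1/(n + 1) + Σ_{t<n} (t + 1)(F_t(s) - F_{t+1}(s))/(n - t).
-- Subtracting consecutive instances shows that x_j = F_{j-1}(s) - F_j(s) solves (T_m + (s - 1) I_m) x = u with
-- u_i = 1/(i(i + 1)). Moreover R_m = u vᵀ with v_j = (m + 1) j/(m - j + 1), and the case n = m of the identity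
-- reads 1 + vᵀx = (m + 1)(s - 1) F_m(s). Since T_m + (s - 1) I_m is lower triangular with determinant
-- Π_{j=1}^m (s + j - 1), the matrix determinant lemma det(A + u vᵀ) = det A · (1 + vᵀ A⁻¹ u) gives the formula.

module Submission where

open import Defs
open import Data.Maybe.Base using (Maybe; just; nothing)
import Data.Nat
open import Data.Nat as ℕ using (ℕ; zero; suc; z≤n; s≤s; _≤_)
import Data.Nat.Properties as ℕP
open import Data.Nat.Combinatorics using (_C_; nCk≡nC[n∸k]; nCk+nC[k+1]≡[n+1]C[k+1]; nCn≡1; nC1≡n)
open import Data.Nat.Combinatorics.Specification using (k>n⇒nCk≡0)
open import Data.Integer as ℤ using (+0; +[1+_]; -[1+_])
import Data.Integer.Properties as ℤP
open import Data.Fin as Fin using (Fin; toℕ; punchIn; punchOut)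
import Data.Fin.Properties as FinP
open import Data.Rational as ℚ using (ℚ; mkℚ; 0ℚ; 1ℚ; _+_; _*_; _-_; -_)
open import Data.Rational.Properties as ℚP
  using (*-zeroˡ; *-zeroʳ; *-identityˡ; *-identityʳ; +-identityˡ; +-identityʳ; +-*-commutativeRing)
import Data.Rational.Unnormalised as ℚᵘ
import Data.Rational.Unnormalised.Properties as ℚᵘP
open import Data.Empty using (⊥-elim)
open import Data.Sum using (inj₁; inj₂)
open import Data.Product using (Σ-syntax; _,_; proj₁; proj₂)
open import Level using (0ℓ)
open import Relation.Nullary using (Dec; yes; no)
open import Relation.Binary.Definitions using (tri<; tri≈; tri>)
open import Relation.Binary.PropositionalEquality
import Tactic.RingSolver.Core.AlmostCommutativeRing as ACR
open import Tactic.RingSolver using (solve-∀)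

ℚ-ring : ACR.AlmostCommutativeRing 0ℓ 0ℓ
ℚ-ring = ACR.fromCommutativeRing +-*-commutativeRing isZero
  where
  isZero : ∀ x → Maybe (0ℚ ≡ x)
  isZero x with 0ℚ ℚP.≟ x
  ... | yes p = just p
  ... | no _ = nothing

toℚᵘ-ℕ→ℚ : ∀ n → ℚ.toℚᵘ (ℕ→ℚ n) ℚᵘ.≃ ℚᵘ.mkℚᵘ (ℤ.+ n) 0
toℚᵘ-ℕ→ℚ n = ℚP.toℚᵘ-fromℚᵘ (ℚᵘ.mkℚᵘ (ℤ.+ n) 0)

ℕ→ℚ-+ : ∀ m n → ℕ→ℚ (m ℕ.+ n) ≡ ℕ→ℚ m + ℕ→ℚ n
ℕ→ℚ-+ m n = ℚP.toℚᵘ-injective (ℚᵘP.≃-trans (toℚᵘ-ℕ→ℚ (m ℕ.+ n))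
  (ℚᵘP.≃-trans (ℚᵘ.*≡* integral) (ℚᵘP.≃-sym (ℚᵘP.≃-trans (ℚP.toℚᵘ-homo-+ (ℕ→ℚ m) (ℕ→ℚ n))
      (ℚᵘP.+-cong (toℚᵘ-ℕ→ℚ m) (toℚᵘ-ℕ→ℚ n))))))
  where
  integral : ℤ.+ (m ℕ.+ n) ℤ.* ℤ.+ 1 ≡ (ℤ.+ m ℤ.* ℤ.+ 1 ℤ.+ ℤ.+ n ℤ.* ℤ.+ 1) ℤ.* ℤ.+ 1
  integral rewrite ℤP.*-identityʳ (ℤ.+ m) | ℤP.*-identityʳ (ℤ.+ n)
                 | ℤP.*-identityʳ (ℤ.+ (m ℕ.+ n)) = sym (ℤP.pos-+ m n)

ℕ→ℚ-* : ∀ m n → ℕ→ℚ (m ℕ.* n) ≡ ℕ→ℚ m * ℕ→ℚ n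
ℕ→ℚ-* m n = ℚP.toℚᵘ-injective (ℚᵘP.≃-trans (toℚᵘ-ℕ→ℚ (m ℕ.* n))
  (ℚᵘP.≃-trans (ℚᵘ.*≡* integral) (ℚᵘP.≃-sym (ℚᵘP.≃-trans (ℚP.toℚᵘ-homo-* (ℕ→ℚ m) (ℕ→ℚ n))
      (ℚᵘP.*-cong (toℚᵘ-ℕ→ℚ m) (toℚᵘ-ℕ→ℚ n))))))
  where
  integral : ℤ.+ (m ℕ.* n) ℤ.* ℤ.+ 1 ≡ (ℤ.+ m ℤ.* ℤ.+ n) ℤ.* ℤ.+ 1
  integral = cong (ℤ._* ℤ.+ 1) (ℤP.pos-* m n)

ℕ→ℚ-suc : ∀ n → ℕ→ℚ (suc n) ≡ 1ℚ + ℕ→ℚ n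
ℕ→ℚ-suc = ℕ→ℚ-+ 1

ℕ→ℚ-suc≢0 : ∀ n → ℕ→ℚ (suc n) ≢ 0ℚ
ℕ→ℚ-suc≢0 n e with ℚᵘP.≃-trans (ℚᵘP.≃-sym (toℚᵘ-ℕ→ℚ (suc n))) (ℚP.toℚᵘ-cong e)
... | ℚᵘ.*≡* ()

1ℚ≢0ℚ : 1ℚ ≢ 0ℚ
1ℚ≢0ℚ ()

inv-inverseʳ : ∀ x → x ≢ 0ℚ → x * inv x ≡ 1ℚ
inv-inverseʳ (mkℚ +0 _ _) x≢0 = ⊥-elim (ℕ.NonZero.nonZero (ℚ.≢-nonZero x≢0))
inv-inverseʳ p@(mkℚ +[1+ _ ] _ _) _ = ℚP.*-inverseʳ p
inv-inverseʳ p@(mkℚ -[1+ _ ] _ _) _ = ℚP.*-inverseʳ p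

inv-inverseˡ : ∀ x → x ≢ 0ℚ → inv x * x ≡ 1ℚ
inv-inverseˡ x x≢0 = trans (ℚP.*-comm (inv x) x) (inv-inverseʳ x x≢0)

neg-*-neg : ∀ x y → - x * - y ≡ x * y
neg-*-neg = solve-∀ ℚ-ring

*-cancelˡ-≢0 : ∀ x y z → x ≢ 0ℚ → x * y ≡ x * z → y ≡ z
*-cancelˡ-≢0 x y z x≢0 e = begin
    y                ≡⟨ sym (*-identityˡ y) ⟩
    1ℚ * y           ≡⟨ cong (_* y) (sym (inv-inverseˡ x x≢0)) ⟩
    inv x * x * y    ≡⟨ ℚP.*-assoc (inv x) x y ⟩
    inv x * (x * y)  ≡⟨ cong (inv x *_) e ⟩
    inv x * (x * z)  ≡⟨ sym (ℚP.*-assoc (inv x) x z) ⟩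
    inv x * x * z    ≡⟨ cong (_* z) (inv-inverseˡ x x≢0) ⟩
    1ℚ * z           ≡⟨ *-identityˡ z ⟩
    z ∎
  where open ≡-Reasoning

*-≢0 : ∀ x y → x ≢ 0ℚ → y ≢ 0ℚ → x * y ≢ 0ℚ
*-≢0 x y x≢0 y≢0 xy≡0 = 1ℚ≢0ℚ (*-cancelˡ-≢0 x 1ℚ 0ℚ x≢0 (*-cancelˡ-≢0 y _ _ y≢0 (begin
    y * (x * 1ℚ)  ≡⟨ cong (y *_) (*-identityʳ x) ⟩
    y * x         ≡⟨ trans (ℚP.*-comm y x) xy≡0 ⟩
    0ℚ            ≡⟨ sym (*-zeroʳ y) ⟩
    y * 0ℚ        ≡⟨ cong (y *_) (sym (*-zeroʳ x)) ⟩
    y * (x * 0ℚ)  ∎)))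
  where open ≡-Reasoning

inv-unique : ∀ x y → x * y ≡ 1ℚ → y ≡ inv x
inv-unique x y xy≡1 = *-cancelˡ-≢0 x y (inv x) x≢0 (trans xy≡1 (sym (inv-inverseʳ x x≢0)))
  where
  x≢0 : x ≢ 0ℚ
  x≢0 x≡0 = 1ℚ≢0ℚ (trans (sym xy≡1) (trans (cong (_* y) x≡0) (*-zeroˡ y)))

inv-* : ∀ x y → inv (x * y) ≡ inv x * inv y
inv-* x y with x ℚP.≟ 0ℚ | y ℚP.≟ 0ℚ
... | yes refl | _ = trans (cong inv (*-zeroˡ y)) (sym (*-zeroˡ (inv y)))
... | no _ | yes refl = trans (cong inv (*-zeroʳ x)) (sym (*-zeroʳ (inv x)))
... | no x≢0 | no y≢0 = sym (inv-unique (x * y) (inv x * inv y) (begin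
    x * y * (inv x * inv y)   ≡⟨ regroup x y (inv x) (inv y) ⟩
    (x * inv x) * (y * inv y) ≡⟨ cong₂ _*_ (inv-inverseʳ x x≢0) (inv-inverseʳ y y≢0) ⟩
    1ℚ ∎))
  where
  open ≡-Reasoning
  regroup : ∀ a b c d → a * b * (c * d) ≡ (a * c) * (b * d)
  regroup = solve-∀ ℚ-ring

inv-cancel₃ : ∀ n p c f → n ≢ 0ℚ → p ≢ 0ℚ → c ≢ 0ℚ → inv n * (p * (n * (c * f))) * (inv c * inv p) ≡ f
inv-cancel₃ n p c f n≢0 p≢0 c≢0 = begin
    inv n * (p * (n * (c * f))) * (inv c * inv p) ≡⟨ regroup n (inv n) p (inv p) c (inv c) f ⟩
    (n * inv n) * (p * inv p) * (c * inv c) * f   ≡⟨ cong₂ (λ x y → x * y * (c * inv c) * f)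
                                                      (inv-inverseʳ n n≢0) (inv-inverseʳ p p≢0) ⟩
    1ℚ * 1ℚ * (c * inv c) * f                     ≡⟨ cong (λ z → 1ℚ * 1ℚ * z * f) (inv-inverseʳ c c≢0) ⟩
    1ℚ * 1ℚ * 1ℚ * f                              ≡⟨ *-identityˡ f ⟩
    f ∎
  where
  open ≡-Reasoning
  regroup : ∀ n n⁻¹ p p⁻¹ c c⁻¹ f →
            n⁻¹ * (p * (n * (c * f))) * (c⁻¹ * p⁻¹) ≡ (n * n⁻¹) * (p * p⁻¹) * (c * c⁻¹) * f
  regroup = solve-∀ ℚ-ring

inv-partialFraction : ∀ d → inv (ℕ→ℚ (suc d)) - inv (ℕ→ℚ (suc (suc d))) ≡ inv (ℕ→ℚ (suc d ℕ.* (suc d ℕ.+ 1)))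
inv-partialFraction d = begin
    inv n - inv (ℕ→ℚ (suc (suc d)))
      ≡⟨ difference-of-inverses n (inv n) (inv (ℕ→ℚ (suc (suc d)))) (inv-inverseʳ n (ℕ→ℚ-suc≢0 d))
           (trans (cong (_* inv (ℕ→ℚ (suc (suc d)))) (sym (ℕ→ℚ-suc (suc d)))) (inv-inverseʳ _ (ℕ→ℚ-suc≢0 (suc d)))) ⟩
    inv n * inv (ℕ→ℚ (suc (suc d)))
      ≡⟨ sym (inv-* n (ℕ→ℚ (suc (suc d)))) ⟩
    inv (n * ℕ→ℚ (suc (suc d)))
      ≡⟨ cong inv (sym (ℕ→ℚ-* (suc d) (suc (suc d)))) ⟩
    inv (ℕ→ℚ (suc d ℕ.* suc (suc d)))
      ≡⟨ cong (λ z → inv (ℕ→ℚ (suc d ℕ.* z))) (ℕP.+-comm 1 (suc d)) ⟩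
    inv (ℕ→ℚ (suc d ℕ.* (suc d ℕ.+ 1))) ∎
  where
  open ≡-Reasoning
  n = ℕ→ℚ (suc d)
  difference-of-inverses : ∀ p i j → p * i ≡ 1ℚ → (1ℚ + p) * j ≡ 1ℚ → i - j ≡ i * j
  difference-of-inverses p i j pi≡1 [1+p]j≡1 = begin
      i - j                          ≡⟨ units i j ⟩
      1ℚ * i - 1ℚ * j                ≡⟨ cong₂ (λ x y → x * i - y * j) (sym [1+p]j≡1) (sym pi≡1) ⟩
      (1ℚ + p) * j * i - p * i * j  ≡⟨ expand p i j ⟩
      i * j                          ∎
    where
    units : ∀ i j → i - j ≡ 1ℚ * i - 1ℚ * j
    units = solve-∀ ℚ-ring
    expand : ∀ p i j → (1ℚ + p) * j * i - p * i * j ≡ i * j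
    expand = solve-∀ ℚ-ring

Σℕ : ℕ → (ℕ → ℚ) → ℚ
Σℕ n g = Σ n (λ i → g (toℕ i))

Σ-cong : ∀ n {f g : Fin n → ℚ} → (∀ i → f i ≡ g i) → Σ n f ≡ Σ n g
Σ-cong zero h = refl
Σ-cong (suc n) h = cong₂ _+_ (h Fin.zero) (Σ-cong n (λ i → h (Fin.suc i)))

private
  +-interchange : ∀ a b c d → (a + b) + (c + d) ≡ (a + c) + (b + d)
  +-interchange = solve-∀ ℚ-ring
  +-leftComm : ∀ a b c → a + (b + c) ≡ b + (a + c)
  +-leftComm = solve-∀ ℚ-ring

Σ-+ : ∀ n (f g : Fin n → ℚ) → Σ n (λ i → f i + g i) ≡ Σ n f + Σ n g
Σ-+ zero f g = refl
Σ-+ (suc n) f g = trans (cong (f Fin.zero + g Fin.zero +_) (Σ-+ n _ _))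
  (+-interchange (f Fin.zero) (g Fin.zero) _ _)

Σ-*ˡ : ∀ n c (f : Fin n → ℚ) → c * Σ n f ≡ Σ n (λ i → c * f i)
Σ-*ˡ zero c f = *-zeroʳ c
Σ-*ˡ (suc n) c f = trans (ℚP.*-distribˡ-+ c (f Fin.zero) (Σ n (λ i → f (Fin.suc i)))) (cong (c * f Fin.zero +_) (Σ-*ˡ n c (λ i → f (Fin.suc i))))

Σ-*ʳ : ∀ n c (f : Fin n → ℚ) → Σ n f * c ≡ Σ n (λ i → f i * c)
Σ-*ʳ zero c f = *-zeroˡ c
Σ-*ʳ (suc n) c f = trans (ℚP.*-distribʳ-+ c (f Fin.zero) (Σ n (λ i → f (Fin.suc i)))) (cong (f Fin.zero * c +_) (Σ-*ʳ n c (λ i → f (Fin.suc i))))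

Σ-zero : ∀ n → Σ n (λ _ → 0ℚ) ≡ 0ℚ
Σ-zero zero = refl
Σ-zero (suc n) = cong (0ℚ +_) (Σ-zero n)

Σ-vanishing : ∀ n (f : Fin n → ℚ) → (∀ i → f i ≡ 0ℚ) → Σ n f ≡ 0ℚ
Σ-vanishing n f h = trans (Σ-cong n h) (Σ-zero n)

Σ-neg : ∀ n (f : Fin n → ℚ) → - Σ n f ≡ Σ n (λ i → - f i)
Σ-neg zero f = refl
Σ-neg (suc n) f = trans (ℚP.neg-distrib-+ (f Fin.zero) (Σ n (λ i → f (Fin.suc i)))) (cong (- f Fin.zero +_) (Σ-neg n (λ i → f (Fin.suc i))))

Σ-swap : ∀ n m (f : Fin n → Fin m → ℚ) →
  Σ n (λ i → Σ m (λ j → f i j)) ≡ Σ m (λ j → Σ n (λ i → f i j))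
Σ-swap zero m f = sym (Σ-zero m)
Σ-swap (suc n) m f = begin
    Σ m (f Fin.zero) + Σ n (λ i → Σ m (λ j → f (Fin.suc i) j))
      ≡⟨ cong (Σ m (f Fin.zero) +_) (Σ-swap n m (λ i → f (Fin.suc i))) ⟩
    Σ m (f Fin.zero) + Σ m (λ j → Σ n (λ i → f (Fin.suc i) j))
      ≡⟨ sym (Σ-+ m _ _) ⟩
    Σ m (λ j → Σ (suc n) (λ i → f i j)) ∎
  where open ≡-Reasoning

Σ-punchIn : ∀ n (j : Fin (suc n)) (h : Fin (suc n) → ℚ) →
  Σ (suc n) h ≡ h j + Σ n (λ k → h (punchIn j k))
Σ-punchIn n Fin.zero h = refl
Σ-punchIn (suc n) (Fin.suc j) h =
  trans (cong (h Fin.zero +_) (Σ-punchIn n j (λ i → h (Fin.suc i))))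
        (+-leftComm (h Fin.zero) (h (Fin.suc j)) _)

Σ-single : ∀ n (j : Fin n) (h : Fin n → ℚ) →
  (∀ k → k ≢ j → h k ≡ 0ℚ) → Σ n h ≡ h j
Σ-single (suc n) j h hz = begin
    Σ (suc n) h ≡⟨ Σ-punchIn n j h ⟩
    h j + Σ n (λ k → h (punchIn j k))
      ≡⟨ cong (h j +_) (Σ-vanishing n _ (λ k → hz (punchIn j k) (λ e → FinP.punchInᵢ≢i j k e))) ⟩
    h j + 0ℚ ≡⟨ +-identityʳ (h j) ⟩
    h j ∎
  where open ≡-Reasoning

Σℕ-last : ∀ n g → Σℕ (suc n) g ≡ Σℕ n g + g n
Σℕ-last zero g = ℚP.+-comm (g 0) 0ℚ
Σℕ-last (suc n) g = begin
    g 0 + Σℕ (suc n) (λ i → g (suc i))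
      ≡⟨ cong (g 0 +_) (Σℕ-last n (λ i → g (suc i))) ⟩
    g 0 + (Σℕ n (λ i → g (suc i)) + g (suc n))
      ≡⟨ sym (ℚP.+-assoc (g 0) _ _) ⟩
    Σℕ (suc n) g + g (suc n) ∎
  where open ≡-Reasoning

Σℕ-cong : ∀ n {f g : ℕ → ℚ} → (∀ i → i ℕ.< n → f i ≡ g i) → Σℕ n f ≡ Σℕ n g
Σℕ-cong zero h = refl
Σℕ-cong (suc n) h = cong₂ _+_ (h 0 (s≤s z≤n)) (Σℕ-cong n (λ i i<n → h (suc i) (s≤s i<n)))

Σℕ-extend : ∀ n k (g : ℕ → ℚ) → (∀ i → n ℕ.≤ i → g i ≡ 0ℚ) → Σℕ (n ℕ.+ k) g ≡ Σℕ n g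
Σℕ-extend zero zero g h = refl
Σℕ-extend zero (suc k) g h = trans (cong₂ _+_ (h 0 z≤n) (Σℕ-extend zero k (λ i → g (suc i)) (λ i _ → h (suc i) z≤n))) (+-identityˡ _)
Σℕ-extend (suc n) k g h = cong (g 0 +_) (Σℕ-extend n k (λ i → g (suc i)) (λ i n≤i → h (suc i) (s≤s n≤i)))

Σ-linear : ∀ n (f g : Fin n → ℚ) a → Σ n (λ j → f j + a * g j) ≡ Σ n f + a * Σ n g
Σ-linear n f g a = trans (Σ-+ n f (λ j → a * g j)) (cong (Σ n f +_) (sym (Σ-*ˡ n a g)))

sgn-*-sgn : ∀ n → sgn n * sgn n ≡ 1ℚ
sgn-*-sgn zero = refl
sgn-*-sgn (suc n) = trans (neg-*-neg (sgn n) (sgn n)) (sgn-*-sgn n)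

sgn-cancel : ∀ j x → sgn j * (sgn j * x) ≡ x
sgn-cancel j x = trans (sym (ℚP.*-assoc (sgn j) (sgn j) x)) (trans (cong (_* x) (sgn-*-sgn j)) (*-identityˡ x))

sgn-cancelˡ : ∀ j x y → sgn j * x * (sgn j * y) ≡ x * y
sgn-cancelˡ j x y = trans (regroup (sgn j) x y) (sgn-cancel j (x * y))
  where
  regroup : ∀ s x y → s * x * (s * y) ≡ s * (s * (x * y))
  regroup = solve-∀ ℚ-ring

Σℕ-truncate : ∀ n L (g : ℕ → ℚ) → n ℕ.≤ L → (∀ i → n ℕ.≤ i → g i ≡ 0ℚ) → Σℕ L g ≡ Σℕ n g
Σℕ-truncate n L g n≤L h = trans (cong (λ z → Σℕ z g) (sym (ℕP.m+[n∸m]≡n n≤L))) (Σℕ-extend n (L ℕ.∸ n) g h)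

Σℕ-sub : ∀ n (f g : ℕ → ℚ) → Σℕ n f - Σℕ n g ≡ Σℕ n (λ k → f k - g k)
Σℕ-sub n f g = trans (cong (Σℕ n f +_) (Σ-neg n (λ k → g (toℕ k)))) (sym (Σ-+ n (λ k → f (toℕ k)) (λ k → - g (toℕ k))))

Π-cong : ∀ n {f g : Fin n → ℚ} → (∀ i → f i ≡ g i) → Π n f ≡ Π n g
Π-cong zero h = refl
Π-cong (suc n) h = cong₂ _*_ (h Fin.zero) (Π-cong n (λ i → h (Fin.suc i)))

Π-≢0 : ∀ n (f : Fin n → ℚ) → (∀ i → f i ≢ 0ℚ) → Π n f ≢ 0ℚ
Π-≢0 zero f h = 1ℚ≢0ℚ
Π-≢0 (suc n) f h = *-≢0 _ _ (h Fin.zero) (Π-≢0 n (λ i → f (Fin.suc i)) (λ i → h (Fin.suc i)))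

-- Determinants

Matrix : ℕ → Set
Matrix n = Fin n → Fin n → ℚ

minor : ∀ {n} → Fin (suc n) → Matrix (suc n) → Matrix n
minor j M i k = M (Fin.suc i) (punchIn j k)

det-cong : ∀ n {M N : Matrix n} → (∀ i j → M i j ≡ N i j) → det n M ≡ det n N
det-cong zero h = refl
det-cong (suc n) {M} {N} h = Σ-cong (suc n) (λ j →
  cong₂ (λ a b → sgn (toℕ j) * a * b) (h Fin.zero j)
        (det-cong n (λ i k → h (Fin.suc i) (punchIn j k))))

setRow : ∀ {n} {A : Set} → Fin n → A → (Fin n → A) → Fin n → A
setRow Fin.zero x R Fin.zero = x
setRow Fin.zero x R (Fin.suc i) = R (Fin.suc i)
setRow (Fin.suc r) x R Fin.zero = R Fin.zero
setRow (Fin.suc r) x R (Fin.suc i) = setRow r x (λ i → R (Fin.suc i)) i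

setRow-map : ∀ {n m} (r : Fin n) (x : Fin m → ℚ) (R : Fin n → Fin m → ℚ) {p} (f : Fin p → Fin m) i k →
  setRow r x R i (f k) ≡ setRow r (λ k → x (f k)) (λ i k → R i (f k)) i k
setRow-map Fin.zero x R f Fin.zero k = refl
setRow-map Fin.zero x R f (Fin.suc i) k = refl
setRow-map (Fin.suc r) x R f Fin.zero k = refl
setRow-map (Fin.suc r) x R f (Fin.suc i) k = setRow-map r x (λ i → R (Fin.suc i)) f i k

setRow-cong : ∀ {n m} (r : Fin n) {x y : Fin m → ℚ} (R : Fin n → Fin m → ℚ) →
  (∀ c → x c ≡ y c) → ∀ i c → setRow r x R i c ≡ setRow r y R i c
setRow-cong Fin.zero R h Fin.zero c = h c
setRow-cong Fin.zero R h (Fin.suc i) c = refl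
setRow-cong (Fin.suc r) R h Fin.zero c = refl
setRow-cong (Fin.suc r) R h (Fin.suc i) c = setRow-cong r (λ i → R (Fin.suc i)) h i c

setRow-updated : ∀ {n} {A : Set} (r : Fin n) (x : A) R → setRow r x R r ≡ x
setRow-updated Fin.zero x R = refl
setRow-updated (Fin.suc r) x R = setRow-updated r x (λ i → R (Fin.suc i))

setRow-unchanged : ∀ {n} {A : Set} (r : Fin n) (x : A) R i → i ≢ r → setRow r x R i ≡ R i
setRow-unchanged Fin.zero x R Fin.zero h = ⊥-elim (h refl)
setRow-unchanged Fin.zero x R (Fin.suc i) h = refl
setRow-unchanged (Fin.suc r) x R Fin.zero h = refl
setRow-unchanged (Fin.suc r) x R (Fin.suc i) h = setRow-unchanged r x (λ i → R (Fin.suc i)) i (λ e → h (cong Fin.suc e))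

minor-setRow : ∀ {n} (r : Fin n) (j : Fin (suc n)) x (M : Matrix (suc n)) i k →
  minor j (setRow (Fin.suc r) x M) i k ≡ setRow r (λ k → x (punchIn j k)) (minor j M) i k
minor-setRow r j x M i k = setRow-map r x (λ i → M (Fin.suc i)) (punchIn j) i k

private
  lin-term : ∀ s x y a d → s * (x + a * y) * d ≡ s * x * d + a * (s * y * d)
  lin-term = solve-∀ ℚ-ring
  lin-term2 : ∀ s m d e a → s * m * (d + a * e) ≡ s * m * d + a * (s * m * e)
  lin-term2 = solve-∀ ℚ-ring

det-linearInRow : ∀ n (r : Fin n) (M : Matrix n) (x y : Fin n → ℚ) a →
  det n (setRow r (λ c → x c + a * y c) M) ≡ det n (setRow r x M) + a * det n (setRow r y M)
det-linearInRow (suc n) Fin.zero M x y a =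
  trans (Σ-cong (suc n) (λ j → lin-term (sgn (toℕ j)) (x j) (y j) a (det n (minor j M))))
        (Σ-linear (suc n) (λ j → sgn (toℕ j) * x j * det n (minor j M)) (λ j → sgn (toℕ j) * y j * det n (minor j M)) a)
det-linearInRow (suc n) (Fin.suc r) M x y a = begin
    Σ (suc n) (λ j → sgn (toℕ j) * M Fin.zero j * det n (minor j (setRow (Fin.suc r) x+ay M)))
      ≡⟨ Σ-cong (suc n) (λ j → cong (sgn (toℕ j) * M Fin.zero j *_) (trans (det-cong n (minor-setRow r j x+ay M))
           (det-linearInRow n r (minor j M) (λ k → x (punchIn j k)) (λ k → y (punchIn j k)) a))) ⟩
    Σ (suc n) (λ j → sgn (toℕ j) * M Fin.zero j * (D x j + a * D y j))
      ≡⟨ Σ-cong (suc n) (λ j → lin-term2 (sgn (toℕ j)) (M Fin.zero j) (D x j) (D y j) a) ⟩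
    Σ (suc n) (λ j → sgn (toℕ j) * M Fin.zero j * D x j + a * (sgn (toℕ j) * M Fin.zero j * D y j))
      ≡⟨ Σ-linear (suc n) (λ j → sgn (toℕ j) * M Fin.zero j * D x j) (λ j → sgn (toℕ j) * M Fin.zero j * D y j) a ⟩
    Σ (suc n) (λ j → sgn (toℕ j) * M Fin.zero j * D x j) + a * Σ (suc n) (λ j → sgn (toℕ j) * M Fin.zero j * D y j)
      ≡⟨ cong₂ (λ p q → p + a * q) (Σ-cong (suc n) (λ j → cong (sgn (toℕ j) * M Fin.zero j *_) (sym (det-cong n (minor-setRow r j x M)))))
                   (Σ-cong (suc n) (λ j → cong (sgn (toℕ j) * M Fin.zero j *_) (sym (det-cong n (minor-setRow r j y M))))) ⟩
    det (suc n) (setRow (Fin.suc r) x M) + a * det (suc n) (setRow (Fin.suc r) y M) ∎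
  where
  open ≡-Reasoning
  x+ay : Fin (suc n) → ℚ
  x+ay c = x c + a * y c
  D : (Fin (suc n) → ℚ) → Fin (suc n) → ℚ
  D w j = det n (setRow r (λ k → w (punchIn j k)) (minor j M))


swapTopRows : ∀ {n} → Matrix (suc (suc n)) → Matrix (suc (suc n))
swapTopRows M Fin.zero = M (Fin.suc Fin.zero)
swapTopRows M (Fin.suc Fin.zero) = M Fin.zero
swapTopRows M (Fin.suc (Fin.suc i)) = M (Fin.suc (Fin.suc i))

punchIn²-swap : ∀ {n} (a b : Fin (suc (suc n))) (ne : a ≢ b) (ne' : b ≢ a) (l : Fin n) →
  punchIn a (punchIn (punchOut ne) l) ≡ punchIn b (punchIn (punchOut ne') l)
punchIn²-swap Fin.zero Fin.zero ne ne' l = ⊥-elim (ne refl)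
punchIn²-swap Fin.zero (Fin.suc b) ne ne' l = refl
punchIn²-swap (Fin.suc a) Fin.zero ne ne' l = refl
punchIn²-swap (Fin.suc a) (Fin.suc b) ne ne' Fin.zero = refl
punchIn²-swap {suc n} (Fin.suc a) (Fin.suc b) ne ne' (Fin.suc l) =
  cong Fin.suc (punchIn²-swap a b (λ e → ne (cong Fin.suc e)) (λ e → ne' (cong Fin.suc e)) l)

sgn-punchOut-swap : ∀ {n} (a b : Fin (suc n)) (ne : a ≢ b) (ne' : b ≢ a) →
  sgn (toℕ a) * sgn (toℕ (punchOut ne)) ≡ - (sgn (toℕ b) * sgn (toℕ (punchOut ne')))
sgn-punchOut-swap Fin.zero Fin.zero ne ne' = ⊥-elim (ne refl)
sgn-punchOut-swap {suc n} Fin.zero (Fin.suc b) ne ne' = flip (sgn (toℕ b))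
  where
  flip : ∀ x → 1ℚ * x ≡ - (- x * 1ℚ)
  flip = solve-∀ ℚ-ring
sgn-punchOut-swap {suc n} (Fin.suc a) Fin.zero ne ne' = flip (sgn (toℕ a))
  where
  flip : ∀ x → - x * 1ℚ ≡ - (1ℚ * x)
  flip = solve-∀ ℚ-ring
sgn-punchOut-swap {suc n} (Fin.suc a) (Fin.suc b) ne ne' = begin
    - sgn (toℕ a) * - sgn (toℕ (punchOut ne₁))   ≡⟨ neg-*-neg (sgn (toℕ a)) _ ⟩
    sgn (toℕ a) * sgn (toℕ (punchOut ne₁))       ≡⟨ sgn-punchOut-swap a b ne₁ ne₁' ⟩
    - (sgn (toℕ b) * sgn (toℕ (punchOut ne₁')))  ≡⟨ cong -_ (sym (neg-*-neg (sgn (toℕ b)) _)) ⟩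
    - (- sgn (toℕ b) * - sgn (toℕ (punchOut ne₁'))) ∎
  where
  open ≡-Reasoning
  ne₁ : a ≢ b
  ne₁ e = ne (cong Fin.suc e)
  ne₁' : b ≢ a
  ne₁' e = ne' (cong Fin.suc e)

-- Expanding along the first two rows gives det M = Σ_{a,b} M₀a M₁b Δ a b with Δ antisymmetric,
-- so exchanging these rows negates the determinant.
module TwoRowExpansion {n : ℕ} (M : Matrix (suc (suc n))) where
  cofactor₂ : (a b : Fin (suc (suc n))) → a ≢ b → ℚ
  cofactor₂ a b ne = sgn (toℕ a) * sgn (toℕ (punchOut ne)) *
              det n (λ i l → M (Fin.suc (Fin.suc i)) (punchIn a (punchIn (punchOut ne) l)))

  cofactor₂-irrelevant : ∀ a b (ne ne' : a ≢ b) → cofactor₂ a b ne ≡ cofactor₂ a b ne'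
  cofactor₂-irrelevant a b ne ne' = cong (λ p → sgn (toℕ a) * sgn (toℕ p) *
              det n (λ i l → M (Fin.suc (Fin.suc i)) (punchIn a (punchIn p l))))
              (FinP.punchOut-cong a refl)

  Δ-dec : (a b : Fin (suc (suc n))) → Dec (a ≡ b) → ℚ
  Δ-dec a b (yes _) = 0ℚ
  Δ-dec a b (no ne) = cofactor₂ a b ne

  Δ : (a b : Fin (suc (suc n))) → ℚ
  Δ a b = Δ-dec a b (a Fin.≟ b)

  Δ-diag : ∀ a → Δ a a ≡ 0ℚ
  Δ-diag a with a Fin.≟ a
  ... | yes _ = refl
  ... | no ne = ⊥-elim (ne refl)

  Δ-off : ∀ a b (ne : a ≢ b) → Δ a b ≡ cofactor₂ a b ne
  Δ-off a b ne with a Fin.≟ b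
  ... | yes e = ⊥-elim (ne e)
  ... | no ne' = cofactor₂-irrelevant a b ne' ne

  Δ-anti : ∀ a b → Δ b a ≡ - Δ a b
  Δ-anti a b with a Fin.≟ b
  ... | yes refl = trans (Δ-diag a) refl
  ... | no ne = trans (Δ-off b a ne') (begin
        sgn (toℕ b) * sgn (toℕ (punchOut ne')) * det n (λ i l → M (Fin.suc (Fin.suc i)) (punchIn b (punchIn (punchOut ne') l)))
          ≡⟨ cong₂ _*_ (sgn-punchOut-swap b a ne' ne) (det-cong n (λ i l → cong (M (Fin.suc (Fin.suc i))) (sym (punchIn²-swap a b ne ne' l)))) ⟩
        - (sgn (toℕ a) * sgn (toℕ (punchOut ne))) * det n (λ i l → M (Fin.suc (Fin.suc i)) (punchIn a (punchIn (punchOut ne) l)))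
          ≡⟨ sym (ℚP.neg-distribˡ-* (sgn (toℕ a) * sgn (toℕ (punchOut ne))) (det n (λ i l → M (Fin.suc (Fin.suc i)) (punchIn a (punchIn (punchOut ne) l))))) ⟩
        - cofactor₂ a b ne ∎)
    where
    open ≡-Reasoning
    ne' : b ≢ a
    ne' e = ne (sym e)

  det-expandTopRows : det (suc (suc n)) M ≡
    Σ (suc (suc n)) (λ a → M Fin.zero a * Σ (suc (suc n)) (λ b → M (Fin.suc Fin.zero) b * Δ a b))
  det-expandTopRows = Σ-cong (suc (suc n)) term
    where
    open ≡-Reasoning
    term : ∀ a → sgn (toℕ a) * M Fin.zero a * det (suc n) (minor a M) ≡
                 M Fin.zero a * Σ (suc (suc n)) (λ b → M (Fin.suc Fin.zero) b * Δ a b)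
    term a = begin
        sgn (toℕ a) * M Fin.zero a * det (suc n) (minor a M)
          ≡⟨ refl ⟩
        sgn (toℕ a) * M Fin.zero a * Σ (suc n) (λ k → sgn (toℕ k) * M (Fin.suc Fin.zero) (punchIn a k) * det n (minor k (minor a M)))
          ≡⟨ cong (sgn (toℕ a) * M Fin.zero a *_) (Σ-cong (suc n) Σ-aShift-invℕ) ⟩
        sgn (toℕ a) * M Fin.zero a * Σ (suc n) (λ k → sgn (toℕ a) * (M (Fin.suc Fin.zero) (punchIn a k) * Δ a (punchIn a k)))
          ≡⟨ cong (sgn (toℕ a) * M Fin.zero a *_) (sym (Σ-*ˡ (suc n) (sgn (toℕ a)) (λ k → M (Fin.suc Fin.zero) (punchIn a k) * Δ a (punchIn a k)))) ⟩
        sgn (toℕ a) * M Fin.zero a * (sgn (toℕ a) * Σ (suc n) (λ k → M (Fin.suc Fin.zero) (punchIn a k) * Δ a (punchIn a k)))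
          ≡⟨ sgn-cancelˡ (toℕ a) (M Fin.zero a) (Σ (suc n) (λ k → M (Fin.suc Fin.zero) (punchIn a k) * Δ a (punchIn a k))) ⟩
        M Fin.zero a * Σ (suc n) (λ k → M (Fin.suc Fin.zero) (punchIn a k) * Δ a (punchIn a k))
          ≡⟨ cong (M Fin.zero a *_) (sym (trans (Σ-punchIn (suc n) a (λ b → M (Fin.suc Fin.zero) b * Δ a b))
                 (trans (cong (_+ Σ (suc n) (λ k → M (Fin.suc Fin.zero) (punchIn a k) * Δ a (punchIn a k)))
                     (trans (cong (M (Fin.suc Fin.zero) a *_) (Δ-diag a)) (*-zeroʳ (M (Fin.suc Fin.zero) a)))) (+-identityˡ _)))) ⟩
        M Fin.zero a * Σ (suc (suc n)) (λ b → M (Fin.suc Fin.zero) b * Δ a b) ∎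
      where
      Σ-aShift-invℕ : ∀ k → sgn (toℕ k) * M (Fin.suc Fin.zero) (punchIn a k) * det n (minor k (minor a M)) ≡
                    sgn (toℕ a) * (M (Fin.suc Fin.zero) (punchIn a k) * Δ a (punchIn a k))
      Σ-aShift-invℕ k = sym (begin
          sgn (toℕ a) * (M (Fin.suc Fin.zero) (punchIn a k) * Δ a (punchIn a k))
            ≡⟨ cong (λ z → sgn (toℕ a) * (M (Fin.suc Fin.zero) (punchIn a k) * z)) (Δ-off a (punchIn a k) ne) ⟩
          sgn (toℕ a) * (M (Fin.suc Fin.zero) (punchIn a k) * cofactor₂ a (punchIn a k) ne)
            ≡⟨ cong (λ p → sgn (toℕ a) * (M (Fin.suc Fin.zero) (punchIn a k) * (sgn (toℕ a) * sgn (toℕ p) *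
                   det n (λ i l → M (Fin.suc (Fin.suc i)) (punchIn a (punchIn p l)))))) pk ⟩
          sgn (toℕ a) * (M (Fin.suc Fin.zero) (punchIn a k) * (sgn (toℕ a) * sgn (toℕ k) * det n (minor k (minor a M))))
            ≡⟨ regroup (sgn (toℕ a)) (M (Fin.suc Fin.zero) (punchIn a k)) (sgn (toℕ k)) (det n (minor k (minor a M))) ⟩
          sgn (toℕ a) * (sgn (toℕ a) * (sgn (toℕ k) * M (Fin.suc Fin.zero) (punchIn a k) * det n (minor k (minor a M))))
            ≡⟨ sgn-cancel (toℕ a) _ ⟩
          sgn (toℕ k) * M (Fin.suc Fin.zero) (punchIn a k) * det n (minor k (minor a M)) ∎)
        where
        ne : a ≢ punchIn a k
        ne e = FinP.punchInᵢ≢i a k (sym e)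
        pk : punchOut ne ≡ k
        pk = FinP.punchIn-injective a _ _ (FinP.punchIn-punchOut ne)
        regroup : ∀ s x t d → s * (x * (s * t * d)) ≡ s * (s * (t * x * d))
        regroup = solve-∀ ℚ-ring

Δ-swap : ∀ n (M : Matrix (suc (suc n))) a b → TwoRowExpansion.Δ (swapTopRows M) a b ≡ TwoRowExpansion.Δ M a b
Δ-swap n M a b with a Fin.≟ b
... | yes _ = refl
... | no _ = refl

det-swapTopRows : ∀ n (M : Matrix (suc (suc n))) → det (suc (suc n)) (swapTopRows M) ≡ - det (suc (suc n)) M
det-swapTopRows n M = begin
    det N (swapTopRows M)
      ≡⟨ TwoRowExpansion.det-expandTopRows (swapTopRows M) ⟩
    Σ N (λ a → M₁ a * Σ N (λ b → M₀ b * TwoRowExpansion.Δ (swapTopRows M) a b))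
      ≡⟨ Σ-cong N (λ a → cong (M₁ a *_) (Σ-cong N (λ b → cong (M₀ b *_) (Δ-swap n M a b)))) ⟩
    Σ N (λ a → M₁ a * Σ N (λ b → M₀ b * Δ a b))
      ≡⟨ Σ-cong N (λ a → Σ-*ˡ N (M₁ a) (λ b → M₀ b * Δ a b)) ⟩
    Σ N (λ a → Σ N (λ b → M₁ a * (M₀ b * Δ a b)))
      ≡⟨ Σ-swap N N (λ a b → M₁ a * (M₀ b * Δ a b)) ⟩
    Σ N (λ b → Σ N (λ a → M₁ a * (M₀ b * Δ a b)))
      ≡⟨ Σ-cong N (λ b → Σ-cong N (λ a → trans (cong (λ z → M₁ a * (M₀ b * z)) (Δ-anti b a)) (swap-neg (M₁ a) (M₀ b) (Δ b a)))) ⟩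
    Σ N (λ b → Σ N (λ a → - (M₀ b * (M₁ a * Δ b a))))
      ≡⟨ Σ-cong N (λ b → sym (Σ-neg N (λ a → M₀ b * (M₁ a * Δ b a)))) ⟩
    Σ N (λ b → - Σ N (λ a → M₀ b * (M₁ a * Δ b a)))
      ≡⟨ sym (Σ-neg N (λ b → Σ N (λ a → M₀ b * (M₁ a * Δ b a)))) ⟩
    - Σ N (λ b → Σ N (λ a → M₀ b * (M₁ a * Δ b a)))
      ≡⟨ cong -_ (Σ-cong N (λ b → sym (Σ-*ˡ N (M₀ b) (λ a → M₁ a * Δ b a)))) ⟩
    - Σ N (λ b → M₀ b * Σ N (λ a → M₁ a * Δ b a))
      ≡⟨ cong -_ (sym (TwoRowExpansion.det-expandTopRows M)) ⟩
    - det N M ∎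
  where
  open ≡-Reasoning
  N = suc (suc n)
  open TwoRowExpansion M using (Δ; Δ-anti)
  M₀ = M Fin.zero
  M₁ = M (Fin.suc Fin.zero)
  swap-neg : ∀ x y d → x * (y * - d) ≡ - (y * (x * d))
  swap-neg = solve-∀ ℚ-ring

x≡-x⇒x≡0 : ∀ x → x ≡ - x → x ≡ 0ℚ
x≡-x⇒x≡0 x e = *-cancelˡ-≢0 (1ℚ + 1ℚ) x 0ℚ (λ ()) (trans (double x) (trans (cong (x +_) e) (trans (ℚP.+-inverseʳ x) (sym (*-zeroʳ (1ℚ + 1ℚ))))))
  where
  double : ∀ x → (1ℚ + 1ℚ) * x ≡ x + x
  double = solve-∀ ℚ-ring

det-equalRows-first : ∀ n (M : Matrix (suc n)) (k : Fin n) → (∀ c → M Fin.zero c ≡ M (Fin.suc k) c) → det (suc n) M ≡ 0ℚ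
det-equalRows-later : ∀ n (M : Matrix (suc n)) (p q : Fin n) → p ≢ q → (∀ c → M (Fin.suc p) c ≡ M (Fin.suc q) c) → det (suc n) M ≡ 0ℚ
det-equalRows : ∀ n (M : Matrix n) (p q : Fin n) → p ≢ q → (∀ c → M p c ≡ M q c) → det n M ≡ 0ℚ

det-equalRows-first (suc n) M Fin.zero h = x≡-x⇒x≡0 _ (trans (sym (det-cong (suc (suc n)) swapped≡M)) (det-swapTopRows n M))
  where
  swapped≡M : ∀ i c → swapTopRows M i c ≡ M i c
  swapped≡M Fin.zero c = sym (h c)
  swapped≡M (Fin.suc Fin.zero) c = h c
  swapped≡M (Fin.suc (Fin.suc i)) c = refl
det-equalRows-first (suc n) M (Fin.suc k) h =
  ℚP.neg-injective (trans (sym (det-swapTopRows n M)) (det-equalRows-later (suc n) (swapTopRows M) Fin.zero (Fin.suc k) (λ ()) h))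
det-equalRows-later (suc n) M p q pq h = Σ-vanishing (suc (suc n)) _ (λ j →
  trans (cong (sgn (toℕ j) * M Fin.zero j *_) (det-equalRows (suc n) (minor j M) p q pq (λ c → h (punchIn j c))))
        (*-zeroʳ (sgn (toℕ j) * M Fin.zero j)))
det-equalRows (suc n) M Fin.zero Fin.zero pq h = ⊥-elim (pq refl)
det-equalRows (suc n) M Fin.zero (Fin.suc q) pq h = det-equalRows-first n M q h
det-equalRows (suc n) M (Fin.suc p) Fin.zero pq h = det-equalRows-first n M p (λ c → sym (h c))
det-equalRows (suc n) M (Fin.suc p) (Fin.suc q) pq h = det-equalRows-later n M p q (λ e → pq (cong Fin.suc e)) h

-- Multilinearity in the rows: the terms taking two or more rows from u vᵀ have repeated rows.
det-rankOneExpansion : ∀ n (A : Matrix n) (u v : Fin n → ℚ) →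
  det n (λ i j → A i j + u i * v j) ≡ det n A + Σ n (λ i → u i * det n (setRow i v A))
det-rankOneExpansion zero A u v = sym (+-identityʳ 1ℚ)
det-rankOneExpansion (suc n) A u v = begin
    Σ N (λ j → s j * (A₀ j + u₀ * v j) * det n (minor j M))
      ≡⟨ Σ-cong N (λ j → cong (s j * (A₀ j + u₀ * v j) *_)
           (det-rankOneExpansion n (minor j A) u' (λ k → v (punchIn j k)))) ⟩
    Σ N (λ j → s j * (A₀ j + u₀ * v j) * (D j + X j))
      ≡⟨ Σ-cong N (λ j → expand (s j) (A₀ j) u₀ (v j) (D j) (X j)) ⟩
    Σ N (λ j → (s j * A₀ j * D j + u₀ * (s j * v j * D j)) + (s j * A₀ j * X j + u₀ * (s j * v j * X j)))
      ≡⟨ Σ-+ N (λ j → s j * A₀ j * D j + u₀ * (s j * v j * D j)) (λ j → s j * A₀ j * X j + u₀ * (s j * v j * X j)) ⟩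
    Σ N (λ j → s j * A₀ j * D j + u₀ * (s j * v j * D j)) + Σ N (λ j → s j * A₀ j * X j + u₀ * (s j * v j * X j))
      ≡⟨ cong₂ _+_ (Σ-linear N (λ j → s j * A₀ j * D j) (λ j → s j * v j * D j) u₀)
                   (Σ-linear N (λ j → s j * A₀ j * X j) (λ j → s j * v j * X j) u₀) ⟩
    (det N A + u₀ * det N (setRow Fin.zero v A)) + (Σ N (λ j → s j * A₀ j * X j) + u₀ * Σ N (λ j → s j * v j * X j))
      ≡⟨ cong₂ (λ p q → (det N A + u₀ * det N (setRow Fin.zero v A)) + (p + u₀ * q)) onceInLowerRows twiceVanishes ⟩
    (det N A + u₀ * det N (setRow Fin.zero v A)) + (Σ n (λ i → u' i * det N (setRow (Fin.suc i) v A)) + u₀ * 0ℚ)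
      ≡⟨ collect (det N A) (u₀ * det N (setRow Fin.zero v A)) (Σ n (λ i → u' i * det N (setRow (Fin.suc i) v A))) u₀ ⟩
    det N A + (u₀ * det N (setRow Fin.zero v A) + Σ n (λ i → u' i * det N (setRow (Fin.suc i) v A))) ∎
  where
  open ≡-Reasoning
  N = suc n
  M = λ i j → A i j + u i * v j
  s = λ (j : Fin N) → sgn (toℕ j)
  A₀ = A Fin.zero
  u₀ = u Fin.zero
  u' = λ i → u (Fin.suc i)
  D = λ j → det n (minor j A)
  E = λ i j → det n (setRow i (λ k → v (punchIn j k)) (minor j A))
  X = λ j → Σ n (λ i → u' i * E i j)
  expand : ∀ s a u₀ v d x → s * (a + u₀ * v) * (d + x) ≡
     (s * a * d + u₀ * (s * v * d)) + (s * a * x + u₀ * (s * v * x))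
  expand = solve-∀ ℚ-ring
  collect : ∀ a b c d → (a + b) + (c + d * 0ℚ) ≡ a + (b + c)
  collect = solve-∀ ℚ-ring
  exchange : ∀ (w : Fin N → ℚ) → Σ N (λ j → s j * w j * X j) ≡ Σ n (λ i → u' i * Σ N (λ j → s j * w j * E i j))
  exchange w = begin
      Σ N (λ j → s j * w j * Σ n (λ i → u' i * E i j))
        ≡⟨ Σ-cong N (λ j → trans (Σ-*ˡ n (s j * w j) (λ i → u' i * E i j))
             (Σ-cong n (λ i → *-leftComm (s j * w j) (u' i) (E i j)))) ⟩
      Σ N (λ j → Σ n (λ i → u' i * (s j * w j * E i j)))
        ≡⟨ Σ-swap N n (λ j i → u' i * (s j * w j * E i j)) ⟩
      Σ n (λ i → Σ N (λ j → u' i * (s j * w j * E i j)))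
        ≡⟨ Σ-cong n (λ i → sym (Σ-*ˡ N (u' i) (λ j → s j * w j * E i j))) ⟩
      Σ n (λ i → u' i * Σ N (λ j → s j * w j * E i j)) ∎
    where
    *-leftComm : ∀ x y z → x * (y * z) ≡ y * (x * z)
    *-leftComm = solve-∀ ℚ-ring
  expandRow : ∀ (w : Fin N → ℚ) i → Σ N (λ j → s j * w j * E i j) ≡ det N (setRow Fin.zero w (setRow (Fin.suc i) v A))
  expandRow w i = Σ-cong N (λ j → cong (s j * w j *_) (sym (det-cong n (minor-setRow i j v A))))
  onceInLowerRows : Σ N (λ j → s j * A₀ j * X j) ≡ Σ n (λ i → u' i * det N (setRow (Fin.suc i) v A))
  onceInLowerRows = trans (exchange A₀) (Σ-cong n (λ i → cong (u' i *_) (expandRow A₀ i)))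
  twiceVanishes : Σ N (λ j → s j * v j * X j) ≡ 0ℚ
  twiceVanishes = trans (exchange v) (Σ-vanishing n _ (λ i → trans (cong (u' i *_) (trans (expandRow v i)
    (det-equalRows N (setRow Fin.zero v (setRow (Fin.suc i) v A)) Fin.zero (Fin.suc i) (λ ())
      (λ c → sym (cong (λ r → r c) (setRow-updated i v (λ i → A (Fin.suc i))))))))
    (*-zeroʳ (u' i))))

x≡x+x⇒x≡0 : ∀ x → x ≡ x + x → x ≡ 0ℚ
x≡x+x⇒x≡0 x e = trans (add-sub x) (trans (cong (_- x) (sym e)) (ℚP.+-inverseʳ x))
  where
  add-sub : ∀ x → x ≡ (x + x) - x
  add-sub = solve-∀ ℚ-ring

det-zeroRow : ∀ n (r : Fin n) (M : Matrix n) → det n (setRow r (λ _ → 0ℚ) M) ≡ 0ℚ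
det-zeroRow n r M = x≡x+x⇒x≡0 _ (trans (det-cong n (setRow-cong r M (λ c → refl)))
  (trans (det-linearInRow n r M (λ _ → 0ℚ) (λ _ → 0ℚ) 1ℚ) (cong (det n (setRow r (λ _ → 0ℚ) M) +_) (*-identityˡ _))))

det-rowCombination : ∀ n (r : Fin n) (M : Matrix n) p (w : Fin p → ℚ) (X : Fin p → Fin n → ℚ) →
  det n (setRow r (λ c → Σ p (λ k → w k * X k c)) M) ≡ Σ p (λ k → w k * det n (setRow r (X k) M))
det-rowCombination n r M zero w X = det-zeroRow n r M
det-rowCombination n r M (suc p) w X = begin
    det n (setRow r (λ c → w Fin.zero * X Fin.zero c + Σ p (λ k → w (Fin.suc k) * X (Fin.suc k) c)) M)
      ≡⟨ det-cong n (setRow-cong r M (λ c → ℚP.+-comm (w Fin.zero * X Fin.zero c) _)) ⟩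
    det n (setRow r (λ c → Σ p (λ k → w (Fin.suc k) * X (Fin.suc k) c) + w Fin.zero * X Fin.zero c) M)
      ≡⟨ det-linearInRow n r M (λ c → Σ p (λ k → w (Fin.suc k) * X (Fin.suc k) c)) (X Fin.zero) (w Fin.zero) ⟩
    det n (setRow r (λ c → Σ p (λ k → w (Fin.suc k) * X (Fin.suc k) c)) M) + w Fin.zero * det n (setRow r (X Fin.zero) M)
      ≡⟨ cong (_+ w Fin.zero * det n (setRow r (X Fin.zero) M)) (det-rowCombination n r M p (λ k → w (Fin.suc k)) (λ k → X (Fin.suc k))) ⟩
    Σ p (λ k → w (Fin.suc k) * det n (setRow r (X (Fin.suc k)) M)) + w Fin.zero * det n (setRow r (X Fin.zero) M)
      ≡⟨ ℚP.+-comm (Σ p (λ k → w (Fin.suc k) * det n (setRow r (X (Fin.suc k)) M))) (w Fin.zero * det n (setRow r (X Fin.zero) M)) ⟩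
    Σ (suc p) (λ k → w k * det n (setRow r (X k) M)) ∎
  where open ≡-Reasoning

setRow-self : ∀ {n} {A : Set} (r : Fin n) (R : Fin n → A) i → setRow r (R r) R i ≡ R i
setRow-self Fin.zero R Fin.zero = refl
setRow-self Fin.zero R (Fin.suc i) = refl
setRow-self (Fin.suc r) R Fin.zero = refl
setRow-self (Fin.suc r) R (Fin.suc i) = setRow-self r (λ i → R (Fin.suc i)) i

det-rowOfCombination : ∀ n (A : Matrix n) (w : Fin n → ℚ) (i : Fin n) →
  det n (setRow i (λ c → Σ n (λ k → w k * A k c)) A) ≡ w i * det n A
det-rowOfCombination n A w i = begin
    det n (setRow i (λ c → Σ n (λ k → w k * A k c)) A)
      ≡⟨ det-rowCombination n i A n w A ⟩
    Σ n (λ k → w k * det n (setRow i (A k) A))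
      ≡⟨ Σ-single n i _ (λ k k≢i → trans (cong (w k *_) (det-equalRows n (setRow i (A k) A) i k (λ e → k≢i (sym e))
            (λ c → trans (cong (λ f → f c) (setRow-updated i (A k) A)) (sym (cong (λ f → f c) (setRow-unchanged i (A k) A k k≢i))))))
            (*-zeroʳ (w k))) ⟩
    w i * det n (setRow i (A i) A)
      ≡⟨ cong (w i *_) (det-cong n (λ j c → cong (λ f → f c) (setRow-self i A j))) ⟩
    w i * det n A ∎
  where open ≡-Reasoning

LowerTriangular : ∀ n → Matrix n → Set
LowerTriangular n A = ∀ i j → toℕ i ℕ.< toℕ j → A i j ≡ 0ℚ

det-lowerTriangular : ∀ n (A : Matrix n) → LowerTriangular n A → det n A ≡ Π n (λ i → A i i)
det-lowerTriangular zero A h = refl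
det-lowerTriangular (suc n) A h = begin
    Σ (suc n) (λ j → sgn (toℕ j) * A Fin.zero j * det n (minor j A))
      ≡⟨ Σ-single (suc n) Fin.zero (λ j → sgn (toℕ j) * A Fin.zero j * det n (minor j A)) (λ { Fin.zero ne → ⊥-elim (ne refl)
            ; (Fin.suc k) ne → trans (cong (λ z → sgn (toℕ (Fin.suc k)) * z * det n (minor (Fin.suc k) A)) (h Fin.zero (Fin.suc k) (s≤s z≤n)))
                  (zero-middle (sgn (toℕ (Fin.suc k))) (det n (minor (Fin.suc k) A))) }) ⟩
    1ℚ * A Fin.zero Fin.zero * det n (minor Fin.zero A)
      ≡⟨ cong₂ _*_ (*-identityˡ (A Fin.zero Fin.zero)) (det-lowerTriangular n (minor Fin.zero A) (λ i j i<j → h (Fin.suc i) (Fin.suc j) (s≤s i<j))) ⟩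
    Π (suc n) (λ i → A i i) ∎
  where
  open ≡-Reasoning
  zero-middle : ∀ s d → s * 0ℚ * d ≡ 0ℚ
  zero-middle = solve-∀ ℚ-ring

lowerTriangular-solveLeft : ∀ n (A : Matrix n) → LowerTriangular n A → (∀ i → A i i ≢ 0ℚ) → (v : Fin n → ℚ) →
  Σ[ w ∈ (Fin n → ℚ) ] (∀ c → Σ n (λ k → w k * A k c) ≡ v c)
lowerTriangular-solveLeft zero A h hd v = (λ ()) , (λ ())
lowerTriangular-solveLeft (suc n) A h hd v = w , eq
  where
  A' : Matrix n
  A' i j = A (Fin.suc i) (Fin.suc j)
  rec = lowerTriangular-solveLeft n A' (λ i j i<j → h (Fin.suc i) (Fin.suc j) (s≤s i<j)) (λ i → hd (Fin.suc i)) (λ c → v (Fin.suc c))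
  w' = proj₁ rec
  rest : ℚ
  rest = Σ n (λ k → w' k * A (Fin.suc k) Fin.zero)
  w₀ : ℚ
  w₀ = (v Fin.zero - rest) * inv (A Fin.zero Fin.zero)
  w : Fin (suc n) → ℚ
  w Fin.zero = w₀
  w (Fin.suc k) = w' k
  eq : ∀ c → Σ (suc n) (λ k → w k * A k c) ≡ v c
  eq Fin.zero = trans (cong (_+ rest) (divide (v Fin.zero - rest) (inv-inverseˡ (A Fin.zero Fin.zero) (hd Fin.zero))))
                      (sub-add (v Fin.zero) rest)
    where
    divide : ∀ x {y a} → y * a ≡ 1ℚ → x * y * a ≡ x
    divide x {y} {a} e = trans (ℚP.*-assoc x y a) (trans (cong (x *_) e) (*-identityʳ x))
    sub-add : ∀ x y → x - y + y ≡ x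
    sub-add = solve-∀ ℚ-ring
  eq (Fin.suc c) = trans (cong (_+ Σ n (λ k → w' k * A (Fin.suc k) (Fin.suc c)))
       (trans (cong (w₀ *_) (h Fin.zero (Fin.suc c) (s≤s z≤n))) (*-zeroʳ w₀)))
       (trans (+-identityˡ _) (proj₂ rec c))

-- If wᵀA = v, replacing row i of A by v multiplies det A by w i, and Σ u i w i = wᵀ A x = vᵀ x.
det-rankOneUpdate : ∀ n (A : Matrix n) → LowerTriangular n A → (∀ i → A i i ≢ 0ℚ) → (u v x : Fin n → ℚ) →
  (∀ i → Σ n (λ k → A i k * x k) ≡ u i) →
  det n (λ i j → A i j + u i * v j) ≡ det n A * (1ℚ + Σ n (λ k → v k * x k))
det-rankOneUpdate n A h hd u v x ax = begin
    det n (λ i j → A i j + u i * v j)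
      ≡⟨ det-rankOneExpansion n A u v ⟩
    det n A + Σ n (λ i → u i * det n (setRow i v A))
      ≡⟨ cong (det n A +_) (Σ-cong n (λ i → cong (u i *_) (trans
            (det-cong n (setRow-cong i A (λ c → sym (proj₂ sl c)))) (det-rowOfCombination n A w i)))) ⟩
    det n A + Σ n (λ i → u i * (w i * det n A))
      ≡⟨ cong (det n A +_) (trans (Σ-cong n (λ i → sym (ℚP.*-assoc (u i) (w i) (det n A))))
           (sym (Σ-*ʳ n (det n A) (λ i → u i * w i)))) ⟩
    det n A + Σ n (λ i → u i * w i) * det n A
      ≡⟨ cong (λ z → det n A + z * det n A) u·w≡v·x ⟩
    det n A + Σ n (λ k → v k * x k) * det n A
      ≡⟨ factor (det n A) (Σ n (λ k → v k * x k)) ⟩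
    det n A * (1ℚ + Σ n (λ k → v k * x k)) ∎
  where
  open ≡-Reasoning
  sl = lowerTriangular-solveLeft n A h hd v
  w = proj₁ sl
  factor : ∀ d s → d + s * d ≡ d * (1ℚ + s)
  factor = solve-∀ ℚ-ring
  u·w≡v·x : Σ n (λ i → u i * w i) ≡ Σ n (λ k → v k * x k)
  u·w≡v·x = begin
      Σ n (λ i → u i * w i)
        ≡⟨ Σ-cong n (λ i → cong (_* w i) (sym (ax i))) ⟩
      Σ n (λ i → Σ n (λ k → A i k * x k) * w i)
        ≡⟨ Σ-cong n (λ i → trans (Σ-*ʳ n (w i) (λ k → A i k * x k)) (Σ-cong n (λ k → regroup (A i k) (x k) (w i)))) ⟩
      Σ n (λ i → Σ n (λ k → x k * (w i * A i k)))
        ≡⟨ Σ-swap n n (λ i k → x k * (w i * A i k)) ⟩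
      Σ n (λ k → Σ n (λ i → x k * (w i * A i k)))
        ≡⟨ Σ-cong n (λ k → trans (sym (Σ-*ˡ n (x k) (λ i → w i * A i k))) (trans (cong (x k *_) (proj₂ sl k)) (ℚP.*-comm (x k) (v k)))) ⟩
      Σ n (λ k → v k * x k) ∎
    where
    regroup : ∀ a x w → a * x * w ≡ x * (w * a)
    regroup = solve-∀ ℚ-ring

-- The coefficients a and the Bernoulli numbers

[1+n]Cn≡1+n : ∀ n → suc n C n ≡ suc n
[1+n]Cn≡1+n n = trans (nCk≡nC[n∸k] (ℕP.n≤1+n n)) (trans (cong (suc n C_) (ℕP.m+n∸n≡m 1 n)) (nC1≡n (suc n)))

aShift : ℕ → ℕ → ℚ
aShift m zero = 0ℚ
aShift m (suc k) = a m k

a-zero : ∀ m → a m 0 ≡ 1ℚ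
a-zero zero = refl
a-zero (suc m) = a-zero m

a-suc : ∀ m k → a (suc m) k ≡ a m k + aShift m k * inv (ℕ→ℚ (suc m))
a-suc m zero = sym (trans (cong (a m 0 +_) (*-zeroˡ (inv (ℕ→ℚ (suc m))))) (+-identityʳ (a m 0)))
a-suc m (suc k) = expand (sgn k) (pcoeff m (suc k)) (pcoeff m k) (inv (ℕ→ℚ (suc m)))
  where
  expand : ∀ s p q i → - s * (p - q * i) ≡ - s * p + s * q * i
  expand = solve-∀ ℚ-ring

a-vanishing : ∀ m k → m ℕ.< k → a m k ≡ 0ℚ
a-vanishing zero (suc k) _ = *-zeroʳ (sgn (suc k))
a-vanishing (suc m) (suc k) (s≤s m<k) = trans (a-suc m (suc k))
  (trans (cong₂ (λ x y → x + y * inv (ℕ→ℚ (suc m))) (a-vanishing m (suc k) (ℕP.m<n⇒m<1+n m<k)) (a-vanishing m k m<k))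
         (zeros (inv (ℕ→ℚ (suc m)))))
  where
  zeros : ∀ i → 0ℚ + 0ℚ * i ≡ 0ℚ
  zeros = solve-∀ ℚ-ring

bernTable-suc : ∀ n k → k ℕ.≤ n → bernTable (suc n) k ≡ bernTable n k
bernTable-suc n k k≤n with k ℕ.≤? n
... | yes _ = refl
... | no k≰n = ⊥-elim (k≰n k≤n)

bernTable≡B : ∀ n k → k ℕ.≤ n → bernTable n k ≡ B k
bernTable≡B zero zero z≤n = refl
bernTable≡B (suc n) k k≤sn with ℕP.m≤n⇒m<n∨m≡n k≤sn
... | inj₂ refl = refl
... | inj₁ (s≤s k≤n) = trans (bernTable-suc n k k≤n) (bernTable≡B n k k≤n)

B-suc : ∀ n → B (suc n) ≡ - (inv (ℕ→ℚ (suc (suc n))) *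
               Σ (suc n) (λ i → ℕ→ℚ (suc (suc n) C toℕ i) * bernTable n (toℕ i)))
B-suc n with suc n ℕ.≤? n
... | yes p = ⊥-elim (ℕP.<-irrefl refl p)
... | no _ = refl

toℕ≤ : ∀ {n} (i : Fin (suc n)) → toℕ i ℕ.≤ n
toℕ≤ i = ℕP.≤-pred (FinP.toℕ<n i)

bernoulli-recurrence : ∀ n → Σℕ (suc (suc n)) (λ i → ℕ→ℚ (suc (suc n) C i) * B i) ≡ 0ℚ
bernoulli-recurrence n = begin
    Σℕ (suc (suc n)) g
      ≡⟨ Σℕ-last (suc n) g ⟩
    Σℕ (suc n) g + g (suc n)
      ≡⟨ cong (Σℕ (suc n) g +_) (cong₂ _*_ (cong ℕ→ℚ ([1+n]Cn≡1+n (suc n))) (B-suc n)) ⟩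
    Σℕ (suc n) g + ℕ→ℚ (suc (suc n)) * - (inv (ℕ→ℚ (suc (suc n))) * Σ0)
      ≡⟨ cong (λ z → z + ℕ→ℚ (suc (suc n)) * - (inv (ℕ→ℚ (suc (suc n))) * Σ0))
           (Σ-cong (suc n) (λ i → cong (ℕ→ℚ (suc (suc n) C toℕ i) *_) (sym (bernTable≡B n (toℕ i) (toℕ≤ i))))) ⟩
    Σ0 + ℕ→ℚ (suc (suc n)) * - (inv (ℕ→ℚ (suc (suc n))) * Σ0)
      ≡⟨ cancel Σ0 (ℕ→ℚ (suc (suc n))) (inv (ℕ→ℚ (suc (suc n)))) (inv-inverseʳ _ (ℕ→ℚ-suc≢0 (suc n))) ⟩
    0ℚ ∎
  where
  open ≡-Reasoning
  g = λ i → ℕ→ℚ (suc (suc n) C i) * B i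
  Σ0 = Σ (suc n) (λ i → ℕ→ℚ (suc (suc n) C toℕ i) * bernTable n (toℕ i))
  cancel : ∀ x p q → p * q ≡ 1ℚ → x + p * - (q * x) ≡ 0ℚ
  cancel x p q e = trans (regroup x p q) (trans (cong (λ z → x - z * x) e) (sub-self x))
    where
    regroup : ∀ x p q → x + p * - (q * x) ≡ x - p * q * x
    regroup = solve-∀ ℚ-ring
    sub-self : ∀ x → x - 1ℚ * x ≡ 0ℚ
    sub-self = solve-∀ ℚ-ring

δ₁ : ℕ → ℚ
δ₁ (suc zero) = 1ℚ
δ₁ _ = 0ℚ

Σ-binomial-B-exact : ∀ n → Σℕ (suc n) (λ k → ℕ→ℚ (n C k) * B k) ≡ B n + δ₁ n
Σ-binomial-B-exact zero = refl
Σ-binomial-B-exact (suc zero) = refl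
Σ-binomial-B-exact (suc (suc n)) = begin
    Σℕ (suc (suc (suc n))) g
      ≡⟨ Σℕ-last (suc (suc n)) g ⟩
    Σℕ (suc (suc n)) g + ℕ→ℚ (suc (suc n) C suc (suc n)) * B (suc (suc n))
      ≡⟨ cong₂ (λ x y → x + ℕ→ℚ y * B (suc (suc n))) (bernoulli-recurrence n) (nCn≡1 (suc (suc n))) ⟩
    0ℚ + 1ℚ * B (suc (suc n))
      ≡⟨ units (B (suc (suc n))) ⟩
    B (suc (suc n)) + 0ℚ ∎
  where
  open ≡-Reasoning
  g = λ k → ℕ→ℚ (suc (suc n) C k) * B k
  units : ∀ x → 0ℚ + 1ℚ * x ≡ x + 0ℚ
  units = solve-∀ ℚ-ring

Σ-binomial-B : ∀ n K → n ℕ.< K → Σℕ K (λ k → ℕ→ℚ (n C k) * B k) ≡ B n + δ₁ n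
Σ-binomial-B n K n<K = trans (Σℕ-truncate (suc n) K (λ k → ℕ→ℚ (n C k) * B k) n<K
    (λ i n<i → trans (cong (λ z → ℕ→ℚ z * B i) (k>n⇒nCk≡0 n<i)) (*-zeroˡ (B i))))
  (Σ-binomial-B-exact n)

umbral-identity : ∀ K (c : ℕ → ℚ) →
  Σℕ (suc (suc K)) (λ k → Σℕ (suc (suc K)) (λ n → c n * ℕ→ℚ (n C k)) * B k) ≡
  Σℕ (suc (suc K)) (λ n → c n * B n) + c 1
umbral-identity K c = begin
    Σℕ N (λ k → Σℕ N (λ n → c n * ℕ→ℚ (n C k)) * B k)
      ≡⟨ Σ-cong N (λ k → Σ-*ʳ N (B (toℕ k)) (λ n → c (toℕ n) * ℕ→ℚ (toℕ n C toℕ k))) ⟩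
    Σ N (λ k → Σ N (λ n → c (toℕ n) * ℕ→ℚ (toℕ n C toℕ k) * B (toℕ k)))
      ≡⟨ Σ-swap N N (λ k n → c (toℕ n) * ℕ→ℚ (toℕ n C toℕ k) * B (toℕ k)) ⟩
    Σ N (λ n → Σ N (λ k → c (toℕ n) * ℕ→ℚ (toℕ n C toℕ k) * B (toℕ k)))
      ≡⟨ Σ-cong N (λ n → trans (Σ-cong N (λ k → ℚP.*-assoc (c (toℕ n)) (ℕ→ℚ (toℕ n C toℕ k)) (B (toℕ k))))
           (sym (Σ-*ˡ N (c (toℕ n)) (λ k → ℕ→ℚ (toℕ n C toℕ k) * B (toℕ k))))) ⟩
    Σ N (λ n → c (toℕ n) * Σℕ N (λ k → ℕ→ℚ (toℕ n C k) * B k))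
      ≡⟨ Σ-cong N (λ n → cong (c (toℕ n) *_) (Σ-binomial-B (toℕ n) N (FinP.toℕ<n n))) ⟩
    Σℕ N (λ n → c n * (B n + δ₁ n))
      ≡⟨ trans (Σ-cong N (λ n → ℚP.*-distribˡ-+ (c (toℕ n)) (B (toℕ n)) (δ₁ (toℕ n)))) (Σ-+ N (λ n → c (toℕ n) * B (toℕ n)) (λ n → c (toℕ n) * δ₁ (toℕ n))) ⟩
    Σℕ N (λ n → c n * B n) + Σℕ N (λ n → c n * δ₁ n)
      ≡⟨ cong (Σℕ N (λ n → c n * B n) +_) last ⟩
    Σℕ N (λ n → c n * B n) + c 1 ∎
  where
  open ≡-Reasoning
  N = suc (suc K)
  last : Σℕ N (λ n → c n * δ₁ n) ≡ c 1
  last = trans (cong₂ (λ x y → x + (c 1 * 1ℚ + y)) (*-zeroʳ (c 0)) (Σ-vanishing K _ (λ i → *-zeroʳ (c (suc (suc (toℕ i)))))))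
     (units (c 1))
    where
    units : ∀ x → 0ℚ + (x * 1ℚ + 0ℚ) ≡ x
    units = solve-∀ ℚ-ring

-- For K > m, binom K m k is the coefficient of xᵏ in q_m(1 + x), and binom-shift is the coefficient form of
-- (1 + x) q_m(1 + x) = (m + 1) q_{m+1}(x).
binom : ℕ → ℕ → ℕ → ℚ
binom K m k = Σℕ K (λ n → a m n * ℕ→ℚ (n C k))

binomShift : ℕ → ℕ → ℕ → ℚ
binomShift K m zero = 0ℚ
binomShift K m (suc k) = binom K m k

Σℕ-dropLast : ∀ K (g : ℕ → ℚ) → g K ≡ 0ℚ → Σℕ (suc K) g ≡ Σℕ K g
Σℕ-dropLast K g h = trans (Σℕ-last K g) (trans (cong (Σℕ K g +_) h) (+-identityʳ _))

Σ-aShift-binom : ∀ K m k → m ℕ.< K → Σℕ (suc K) (λ n → aShift m n * ℕ→ℚ (n C k)) ≡ binom (suc K) m k + binomShift (suc K) m k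
Σ-aShift-binom K m zero m<K = begin
    0ℚ * 1ℚ + Σℕ K (λ n → a m n * ℕ→ℚ (suc n C 0))
      ≡⟨ +-identityˡ _ ⟩
    Σℕ K (λ n → a m n * ℕ→ℚ (n C 0))
      ≡⟨ sym (Σℕ-dropLast K (λ n → a m n * ℕ→ℚ (n C 0)) (trans (cong (_* ℕ→ℚ (K C 0)) (a-vanishing m K m<K)) (*-zeroˡ (ℕ→ℚ (K C 0))))) ⟩
    binom (suc K) m 0
      ≡⟨ sym (+-identityʳ _) ⟩
    binom (suc K) m 0 + 0ℚ ∎
  where open ≡-Reasoning
Σ-aShift-binom K m (suc k) m<K = begin
    0ℚ * ℕ→ℚ (0 C suc k) + Σℕ K (λ n → a m n * ℕ→ℚ (suc n C suc k))
      ≡⟨ +-identityˡ _ ⟩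
    Σℕ K (λ n → a m n * ℕ→ℚ (suc n C suc k))
      ≡⟨ Σ-cong K (λ n → trans (cong (λ z → a m (toℕ n) * ℕ→ℚ z) (sym (nCk+nC[k+1]≡[n+1]C[k+1] (toℕ n) k)))
            (trans (cong (a m (toℕ n) *_) (ℕ→ℚ-+ (toℕ n C k) (toℕ n C suc k))) (ℚP.*-distribˡ-+ (a m (toℕ n)) _ _))) ⟩
    Σℕ K (λ n → a m n * ℕ→ℚ (n C k) + a m n * ℕ→ℚ (n C suc k))
      ≡⟨ Σ-+ K (λ n → a m (toℕ n) * ℕ→ℚ (toℕ n C k)) (λ n → a m (toℕ n) * ℕ→ℚ (toℕ n C suc k)) ⟩
    Σℕ K (λ n → a m n * ℕ→ℚ (n C k)) + Σℕ K (λ n → a m n * ℕ→ℚ (n C suc k))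
      ≡⟨ cong₂ _+_ (sym (Σℕ-dropLast K (λ n → a m n * ℕ→ℚ (n C k)) (top-vanishes k))) (sym (Σℕ-dropLast K (λ n → a m n * ℕ→ℚ (n C suc k)) (top-vanishes (suc k)))) ⟩
    binom (suc K) m k + binom (suc K) m (suc k)
      ≡⟨ ℚP.+-comm (binom (suc K) m k) (binom (suc K) m (suc k)) ⟩
    binom (suc K) m (suc k) + binomShift (suc K) m (suc k) ∎
  where
  open ≡-Reasoning
  top-vanishes : ∀ j → a m K * ℕ→ℚ (K C j) ≡ 0ℚ
  top-vanishes j = trans (cong (_* ℕ→ℚ (K C j)) (a-vanishing m K m<K)) (*-zeroˡ (ℕ→ℚ (K C j)))

binom-zero : ∀ K k → binom (suc K) 0 k ≡ ℕ→ℚ (0 C k)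
binom-zero K k = trans (cong₂ _+_ (*-identityˡ (ℕ→ℚ (0 C k))) (Σ-vanishing K _ (λ n →
    trans (cong (_* ℕ→ℚ (suc (toℕ n) C k)) (a-vanishing 0 (suc (toℕ n)) (s≤s z≤n))) (*-zeroˡ (ℕ→ℚ (suc (toℕ n) C k))))))
  (+-identityʳ _)

binom-shift : ∀ K m → suc m ℕ.< K → ∀ k → binom K m k + binomShift K m k ≡ ℕ→ℚ (suc m) * a (suc m) k
binom-suc : ∀ K m → suc (suc m) ℕ.< K → ∀ k → binom K (suc m) k ≡ binom K m k + a (suc m) k

binom-shift (suc K) zero h zero = trans (cong (_+ 0ℚ) (binom-zero K 0)) refl
binom-shift (suc K) zero h (suc zero) = trans (cong₂ _+_ (binom-zero K 1) (binom-zero K 0)) refl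
binom-shift (suc K) zero h (suc (suc k)) = trans (cong₂ _+_ (binom-zero K (suc (suc k))) (binom-zero K (suc k)))
   (sym (trans (cong (ℕ→ℚ 1 *_) (a-vanishing 1 (suc (suc k)) (s≤s (s≤s z≤n)))) refl))
binom-shift K (suc m) h k = begin
    binom K (suc m) k + binomShift K (suc m) k
      ≡⟨ cong (_+ binomShift K (suc m) k) (binom-suc K m h k) ⟩
    binom K m k + a (suc m) k + binomShift K (suc m) k
      ≡⟨ cong (binom K m k + a (suc m) k +_) (pstep k) ⟩
    binom K m k + a (suc m) k + (binomShift K m k + aShift (suc m) k)
      ≡⟨ rearrange (binom K m k) (a (suc m) k) (binomShift K m k) (aShift (suc m) k) ⟩
    (binom K m k + binomShift K m k) + a (suc m) k + aShift (suc m) k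
      ≡⟨ cong (λ z → z + a (suc m) k + aShift (suc m) k) (binom-shift K m (ℕP.<-trans (ℕP.n<1+n _) h) k) ⟩
    ℕ→ℚ (suc m) * a (suc m) k + a (suc m) k + aShift (suc m) k
      ≡⟨ cong (λ z → ℕ→ℚ (suc m) * a (suc m) k + a (suc m) k + z)
           (sym (cancel (aShift (suc m) k) (ℕ→ℚ (suc (suc m))) (inv (ℕ→ℚ (suc (suc m))))
                        (inv-inverseʳ (ℕ→ℚ (suc (suc m))) (ℕ→ℚ-suc≢0 (suc m))))) ⟩
    ℕ→ℚ (suc m) * a (suc m) k + a (suc m) k + ℕ→ℚ (suc (suc m)) * (aShift (suc m) k * inv (ℕ→ℚ (suc (suc m))))
      ≡⟨ cong (λ z → ℕ→ℚ (suc m) * a (suc m) k + a (suc m) k + z * (aShift (suc m) k * inv (ℕ→ℚ (suc (suc m))))) (ℕ→ℚ-suc (suc m)) ⟩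
    ℕ→ℚ (suc m) * a (suc m) k + a (suc m) k + (1ℚ + ℕ→ℚ (suc m)) * (aShift (suc m) k * inv (ℕ→ℚ (suc (suc m))))
      ≡⟨ factor (ℕ→ℚ (suc m)) (a (suc m) k) (aShift (suc m) k * inv (ℕ→ℚ (suc (suc m)))) ⟩
    (1ℚ + ℕ→ℚ (suc m)) * (a (suc m) k + aShift (suc m) k * inv (ℕ→ℚ (suc (suc m))))
      ≡⟨ cong₂ _*_ (sym (ℕ→ℚ-suc (suc m))) (sym (a-suc (suc m) k)) ⟩
    ℕ→ℚ (suc (suc m)) * a (suc (suc m)) k ∎
  where
  open ≡-Reasoning
  pstep : ∀ k → binomShift K (suc m) k ≡ binomShift K m k + aShift (suc m) k
  pstep zero = refl
  pstep (suc k) = binom-suc K m h k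
  rearrange : ∀ s a p q → s + a + (p + q) ≡ (s + p) + a + q
  rearrange = solve-∀ ℚ-ring
  factor : ∀ n a x → n * a + a + (1ℚ + n) * x ≡ (1ℚ + n) * (a + x)
  factor = solve-∀ ℚ-ring
  cancel : ∀ p n i → n * i ≡ 1ℚ → n * (p * i) ≡ p
  cancel p n i e = trans (*-leftComm n p i) (trans (cong (p *_) e) (*-identityʳ p))
    where
    *-leftComm : ∀ n p i → n * (p * i) ≡ p * (n * i)
    *-leftComm = solve-∀ ℚ-ring

binom-suc (suc K) m h k = begin
    binom (suc K) (suc m) k
      ≡⟨ Σ-cong (suc K) (λ n → trans (cong (_* ℕ→ℚ (toℕ n C k)) (a-suc m (toℕ n)))
           (ℚP.*-distribʳ-+ (ℕ→ℚ (toℕ n C k)) (a m (toℕ n)) (aShift m (toℕ n) * inv (ℕ→ℚ (suc m))))) ⟩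
    Σℕ (suc K) (λ n → a m n * ℕ→ℚ (n C k) + aShift m n * inv (ℕ→ℚ (suc m)) * ℕ→ℚ (n C k))
      ≡⟨ Σ-+ (suc K) (λ n → a m (toℕ n) * ℕ→ℚ (toℕ n C k)) (λ n → aShift m (toℕ n) * inv (ℕ→ℚ (suc m)) * ℕ→ℚ (toℕ n C k)) ⟩
    binom (suc K) m k + Σℕ (suc K) (λ n → aShift m n * inv (ℕ→ℚ (suc m)) * ℕ→ℚ (n C k))
      ≡⟨ cong (binom (suc K) m k +_) (trans (Σ-cong (suc K) (λ n → regroup (aShift m (toℕ n)) (inv (ℕ→ℚ (suc m))) (ℕ→ℚ (toℕ n C k))))
           (sym (Σ-*ˡ (suc K) (inv (ℕ→ℚ (suc m))) (λ n → aShift m (toℕ n) * ℕ→ℚ (toℕ n C k))))) ⟩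
    binom (suc K) m k + inv (ℕ→ℚ (suc m)) * Σℕ (suc K) (λ n → aShift m n * ℕ→ℚ (n C k))
      ≡⟨ cong (λ z → binom (suc K) m k + inv (ℕ→ℚ (suc m)) * z) (Σ-aShift-binom K m k (ℕP.<-trans (ℕP.n<1+n _) (ℕP.≤-pred h))) ⟩
    binom (suc K) m k + inv (ℕ→ℚ (suc m)) * (binom (suc K) m k + binomShift (suc K) m k)
      ≡⟨ cong (λ z → binom (suc K) m k + inv (ℕ→ℚ (suc m)) * z) (binom-shift (suc K) m (ℕP.<-trans (ℕP.n<1+n _) h) k) ⟩
    binom (suc K) m k + inv (ℕ→ℚ (suc m)) * (ℕ→ℚ (suc m) * a (suc m) k)
      ≡⟨ cong (binom (suc K) m k +_) (cancel (a (suc m) k) (inv (ℕ→ℚ (suc m))) (ℕ→ℚ (suc m)) (inv-inverseˡ (ℕ→ℚ (suc m)) (ℕ→ℚ-suc≢0 m))) ⟩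
    binom (suc K) m k + a (suc m) k ∎
  where
  open ≡-Reasoning
  regroup : ∀ p i c → p * i * c ≡ i * (p * c)
  regroup = solve-∀ ℚ-ring
  cancel : ∀ x i n → i * n ≡ 1ℚ → i * (n * x) ≡ x
  cancel x i n e = trans (sym (ℚP.*-assoc i n x)) (trans (cong (_* x) e) (*-identityˡ x))

-- The umbral identity for c = aShift m / (m + 1), whose binomial transform is a (m + 1) by binom-shift.
Σ-a-B-exact : ∀ m → Σℕ (suc (suc m)) (λ k → a m k * B k) ≡ inv (ℕ→ℚ (suc m))
Σ-a-B-exact m = begin
    Σℕ K (λ k → a m k * B k)
      ≡⟨ add-sub (Σℕ K (λ k → a m k * B k)) (Σℕ K (λ k → f k * B k)) ⟩
    (Σℕ K (λ k → a m k * B k) + Σℕ K (λ k → f k * B k)) - Σℕ K (λ k → f k * B k)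
      ≡⟨ cong (_- Σℕ K (λ k → f k * B k)) (sym (Σ-+ K (λ k → a m (toℕ k) * B (toℕ k)) (λ k → f (toℕ k) * B (toℕ k)))) ⟩
    Σℕ K (λ k → a m k * B k + f k * B k) - Σℕ K (λ k → f k * B k)
      ≡⟨ cong (_- Σℕ K (λ k → f k * B k)) (Σ-cong K (λ k → trans (sym (ℚP.*-distribʳ-+ (B (toℕ k)) (a m (toℕ k)) (f (toℕ k))))
            (cong (_* B (toℕ k)) (trans (sym (a-suc m (toℕ k))) (sym (Sf≡a (toℕ k))))))) ⟩
    Σℕ K (λ k → Sf k * B k) - Σℕ K (λ k → f k * B k)
      ≡⟨ cong (_- Σℕ K (λ k → f k * B k)) (umbral-identity m f) ⟩
    (Σℕ K (λ k → f k * B k) + f 1) - Σℕ K (λ k → f k * B k)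
      ≡⟨ add-sub-cancel (Σℕ K (λ k → f k * B k)) (f 1) ⟩
    f 1
      ≡⟨ cong (_* inv (ℕ→ℚ (suc m))) (a-zero m) ⟩
    1ℚ * inv (ℕ→ℚ (suc m))
      ≡⟨ *-identityˡ _ ⟩
    inv (ℕ→ℚ (suc m)) ∎
  where
  open ≡-Reasoning
  K = suc (suc m)
  add-sub : ∀ x y → x ≡ (x + y) - y
  add-sub = solve-∀ ℚ-ring
  add-sub-cancel : ∀ x y → (x + y) - x ≡ y
  add-sub-cancel = solve-∀ ℚ-ring
  regroup : ∀ p i c → p * i * c ≡ i * (p * c)
  regroup = solve-∀ ℚ-ring
  f : ℕ → ℚ
  f n = aShift m n * inv (ℕ→ℚ (suc m))
  Sf : ℕ → ℚ
  Sf k = Σℕ K (λ n → f n * ℕ→ℚ (n C k))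
  Sf≡a : ∀ k → Sf k ≡ a (suc m) k
  Sf≡a k = begin
      Σℕ K (λ n → f n * ℕ→ℚ (n C k))
        ≡⟨ Σ-cong K (λ n → regroup (aShift m (toℕ n)) (inv (ℕ→ℚ (suc m))) (ℕ→ℚ (toℕ n C k))) ⟩
      Σℕ K (λ n → inv (ℕ→ℚ (suc m)) * (aShift m n * ℕ→ℚ (n C k)))
        ≡⟨ sym (Σ-*ˡ K (inv (ℕ→ℚ (suc m))) (λ n → aShift m (toℕ n) * ℕ→ℚ (toℕ n C k))) ⟩
      inv (ℕ→ℚ (suc m)) * Σℕ K (λ n → aShift m n * ℕ→ℚ (n C k))
        ≡⟨ cong (inv (ℕ→ℚ (suc m)) *_) (Σ-aShift-binom (suc m) m k (ℕP.n<1+n m)) ⟩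
      inv (ℕ→ℚ (suc m)) * (binom K m k + binomShift K m k)
        ≡⟨ cong (inv (ℕ→ℚ (suc m)) *_) (binom-shift K m (ℕP.n<1+n (suc m)) k) ⟩
      inv (ℕ→ℚ (suc m)) * (ℕ→ℚ (suc m) * a (suc m) k)
        ≡⟨ sym (ℚP.*-assoc (inv (ℕ→ℚ (suc m))) (ℕ→ℚ (suc m)) (a (suc m) k)) ⟩
      inv (ℕ→ℚ (suc m)) * ℕ→ℚ (suc m) * a (suc m) k
        ≡⟨ cong (_* a (suc m) k) (inv-inverseˡ (ℕ→ℚ (suc m)) (ℕ→ℚ-suc≢0 m)) ⟩
      1ℚ * a (suc m) k
        ≡⟨ *-identityˡ _ ⟩
      a (suc m) k ∎

Σ-a-B : ∀ n L → n ℕ.< L → Σℕ L (λ k → a n k * B k) ≡ inv (ℕ→ℚ (suc n))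
Σ-a-B n L n<L = trans (Σℕ-truncate (suc n) L g n<L beyond-n)
  (trans (sym (Σℕ-truncate (suc n) (suc (suc n)) g (ℕP.n≤1+n _) beyond-n)) (Σ-a-B-exact n))
  where
  g = λ k → a n k * B k
  beyond-n : ∀ i → suc n ℕ.≤ i → g i ≡ 0ℚ
  beyond-n i h = trans (cong (_* B i) (a-vanishing n i h)) (*-zeroˡ (B i))

-- A convolution identity for F

invℕ : ℕ → ℚ
invℕ d = inv (ℕ→ℚ d)

invℕ-inverse : ∀ d → ℕ→ℚ (suc d) * invℕ (suc d) ≡ 1ℚ
invℕ-inverse d = inv-inverseʳ _ (ℕ→ℚ-suc≢0 d)

invℕ-∸-difference : ∀ i t → t ℕ.< i → invℕ (i ℕ.∸ t) - invℕ (suc i ℕ.∸ t) ≡ inv (ℕ→ℚ ((i ℕ.∸ t) ℕ.* (i ℕ.∸ t ℕ.+ 1)))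
invℕ-∸-difference i t t<i =
  trans (cong (λ z → invℕ (i ℕ.∸ t) - invℕ z) (ℕP.+-∸-assoc 1 (ℕP.<⇒≤ t<i)))
        (subst (λ n → invℕ n - invℕ (suc n) ≡ inv (ℕ→ℚ (n ℕ.* (n ℕ.+ 1))))
               (sym (ℕP.+-∸-assoc 1 t<i)) (inv-partialFraction (i ℕ.∸ suc t)))

Σ-invℕ-split : ∀ N (f : ℕ → ℚ) → ℕ→ℚ N * Σℕ (suc N) (λ t → f t * invℕ (N ℕ.∸ t)) ≡
      Σℕ (suc N) (λ t → ℕ→ℚ t * f t * invℕ (N ℕ.∸ t)) + Σℕ N f
Σ-invℕ-split N f = begin
    ℕ→ℚ N * Σℕ (suc N) (λ t → f t * invℕ (N ℕ.∸ t))
      ≡⟨ Σ-*ˡ (suc N) (ℕ→ℚ N) (λ t → f (toℕ t) * invℕ (N ℕ.∸ toℕ t)) ⟩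
    Σℕ (suc N) (λ t → ℕ→ℚ N * (f t * invℕ (N ℕ.∸ t)))
      ≡⟨ Σℕ-cong (suc N) (λ t t<sN → trans (cong (λ z → z * (f t * invℕ (N ℕ.∸ t)))
            (trans (cong ℕ→ℚ (sym (ℕP.m+[n∸m]≡n (ℕP.≤-pred t<sN)))) (ℕ→ℚ-+ t (N ℕ.∸ t))))
            (distribute (ℕ→ℚ t) (ℕ→ℚ (N ℕ.∸ t)) (f t) (invℕ (N ℕ.∸ t)))) ⟩
    Σℕ (suc N) (λ t → ℕ→ℚ t * f t * invℕ (N ℕ.∸ t) + ℕ→ℚ (N ℕ.∸ t) * invℕ (N ℕ.∸ t) * f t)
      ≡⟨ Σ-+ (suc N) (λ t → ℕ→ℚ (toℕ t) * f (toℕ t) * invℕ (N ℕ.∸ toℕ t)) (λ t → ℕ→ℚ (N ℕ.∸ toℕ t) * invℕ (N ℕ.∸ toℕ t) * f (toℕ t)) ⟩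
    Σℕ (suc N) (λ t → ℕ→ℚ t * f t * invℕ (N ℕ.∸ t)) + Σℕ (suc N) (λ t → ℕ→ℚ (N ℕ.∸ t) * invℕ (N ℕ.∸ t) * f t)
      ≡⟨ cong (Σℕ (suc N) (λ t → ℕ→ℚ t * f t * invℕ (N ℕ.∸ t)) +_) second ⟩
    Σℕ (suc N) (λ t → ℕ→ℚ t * f t * invℕ (N ℕ.∸ t)) + Σℕ N f ∎
  where
  open ≡-Reasoning
  distribute : ∀ x y p q → (x + y) * (p * q) ≡ x * p * q + y * q * p
  distribute = solve-∀ ℚ-ring
  second : Σℕ (suc N) (λ t → ℕ→ℚ (N ℕ.∸ t) * invℕ (N ℕ.∸ t) * f t) ≡ Σℕ N f
  second = trans (Σℕ-dropLast N (λ t → ℕ→ℚ (N ℕ.∸ t) * invℕ (N ℕ.∸ t) * f t) (trans (cong (λ z → ℕ→ℚ z * invℕ z * f N) (ℕP.n∸n≡0 N)) (*-zeroˡ (f N))))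
    (Σℕ-cong N (λ t t<N → trans (cong (_* f t) (trans (cong (λ z → ℕ→ℚ z * invℕ z) (ℕP.+-∸-assoc 1 t<N)) (invℕ-inverse (N ℕ.∸ suc t))))
       (*-identityˡ (f t))))

-- The term t = N of conv N k vanishes (inv 0 = 0); conv≡derivative is the coefficient form of
-- q_N′ = Σ_{t<N} q_t / (N - t).
conv : ℕ → ℕ → ℚ
conv N k = Σℕ (suc N) (λ t → a t k * invℕ (N ℕ.∸ t))

convShift : ℕ → ℕ → ℚ
convShift N zero = 0ℚ
convShift N (suc k) = conv N k

Σ-aShift-conv : ∀ N k → Σℕ (suc N) (λ t → aShift t k * invℕ (N ℕ.∸ t)) ≡ convShift N k
Σ-aShift-conv N zero = Σ-vanishing (suc N) (λ t → 0ℚ * invℕ (N ℕ.∸ toℕ t)) (λ t → *-zeroˡ (invℕ (N ℕ.∸ toℕ t)))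
Σ-aShift-conv N (suc k) = refl

Σ-weighted-conv : ∀ N k → Σℕ (suc (suc N)) (λ t → ℕ→ℚ t * a t k * invℕ (suc N ℕ.∸ t)) ≡
             Σℕ (suc N) (λ t → ℕ→ℚ (suc t) * a t k * invℕ (N ℕ.∸ t)) + convShift N k
Σ-weighted-conv N k = begin
    0ℚ * a 0 k * invℕ (suc N) + Σℕ (suc N) (λ t → ℕ→ℚ (suc t) * a (suc t) k * invℕ (N ℕ.∸ t))
      ≡⟨ cong₂ _+_ (zero-left (a 0 k) (invℕ (suc N))) (Σℕ-cong (suc N) (λ t _ → step t)) ⟩
    0ℚ + Σℕ (suc N) (λ t → ℕ→ℚ (suc t) * a t k * invℕ (N ℕ.∸ t) + aShift t k * invℕ (N ℕ.∸ t))
      ≡⟨ +-identityˡ _ ⟩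
    Σℕ (suc N) (λ t → ℕ→ℚ (suc t) * a t k * invℕ (N ℕ.∸ t) + aShift t k * invℕ (N ℕ.∸ t))
      ≡⟨ Σ-+ (suc N) (λ t → ℕ→ℚ (suc (toℕ t)) * a (toℕ t) k * invℕ (N ℕ.∸ toℕ t)) (λ t → aShift (toℕ t) k * invℕ (N ℕ.∸ toℕ t)) ⟩
    Σℕ (suc N) (λ t → ℕ→ℚ (suc t) * a t k * invℕ (N ℕ.∸ t)) + Σℕ (suc N) (λ t → aShift t k * invℕ (N ℕ.∸ t))
      ≡⟨ cong (Σℕ (suc N) (λ t → ℕ→ℚ (suc t) * a t k * invℕ (N ℕ.∸ t)) +_) (Σ-aShift-conv N k) ⟩
    Σℕ (suc N) (λ t → ℕ→ℚ (suc t) * a t k * invℕ (N ℕ.∸ t)) + convShift N k ∎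
  where
  open ≡-Reasoning
  zero-left : ∀ x y → 0ℚ * x * y ≡ 0ℚ
  zero-left = solve-∀ ℚ-ring
  step : ∀ t → ℕ→ℚ (suc t) * a (suc t) k * invℕ (N ℕ.∸ t) ≡ ℕ→ℚ (suc t) * a t k * invℕ (N ℕ.∸ t) + aShift t k * invℕ (N ℕ.∸ t)
  step t = trans (cong (λ z → ℕ→ℚ (suc t) * z * invℕ (N ℕ.∸ t)) (a-suc t k))
    (cancel-suc (ℕ→ℚ (suc t)) (a t k) (aShift t k) (inv (ℕ→ℚ (suc t))) (invℕ (N ℕ.∸ t)) (invℕ-inverse t))
    where
    cancel-suc : ∀ n x p i h → n * i ≡ 1ℚ → n * (x + p * i) * h ≡ n * x * h + p * h
    cancel-suc n x p i h e = trans (regroup n x p i h) (trans (cong (λ z → n * x * h + z * p * h) e) (unit n x p h))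
      where
      regroup : ∀ n x p i h → n * (x + p * i) * h ≡ n * x * h + (n * i) * p * h
      regroup = solve-∀ ℚ-ring
      unit : ∀ n x p h → n * x * h + 1ℚ * p * h ≡ n * x * h + p * h
      unit = solve-∀ ℚ-ring

conv-recurrence : ∀ N k → ℕ→ℚ (suc N) * conv (suc N) k ≡ ℕ→ℚ (suc N) * conv N k + convShift N k + a N k
conv-recurrence N k = begin
    ℕ→ℚ (suc N) * conv (suc N) k
      ≡⟨ Σ-invℕ-split (suc N) (λ t → a t k) ⟩
    Σℕ (suc (suc N)) (λ t → ℕ→ℚ t * a t k * invℕ (suc N ℕ.∸ t)) + Σℕ (suc N) (λ t → a t k)
      ≡⟨ cong₂ _+_ (Σ-weighted-conv N k) (Σℕ-last N (λ t → a t k)) ⟩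
    Σℕ (suc N) (λ t → ℕ→ℚ (suc t) * a t k * invℕ (N ℕ.∸ t)) + convShift N k + (Σℕ N (λ t → a t k) + a N k)
      ≡⟨ cong (λ z → z + convShift N k + (Σℕ N (λ t → a t k) + a N k)) split ⟩
    (X + Y) + convShift N k + (Σℕ N (λ t → a t k) + a N k)
      ≡⟨ rearrange (X) (Y) (convShift N k) (Σℕ N (λ t → a t k)) (a N k) ⟩
    (Y + (X + Σℕ N (λ t → a t k))) + convShift N k + a N k
      ≡⟨ cong (λ z → (Y + z) + convShift N k + a N k) (sym (Σ-invℕ-split N (λ t → a t k))) ⟩
    (Y + ℕ→ℚ N * conv N k) + convShift N k + a N k
      ≡⟨ cong (λ z → z + convShift N k + a N k) (trans (factor Y (ℕ→ℚ N)) (cong (_* Y) (sym (ℕ→ℚ-suc N)))) ⟩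
    ℕ→ℚ (suc N) * conv N k + convShift N k + a N k ∎
  where
  open ≡-Reasoning
  X = Σℕ (suc N) (λ t → ℕ→ℚ t * a t k * invℕ (N ℕ.∸ t))
  Y = conv N k
  rearrange : ∀ x y p s a → (x + y) + p + (s + a) ≡ (y + (x + s)) + p + a
  rearrange = solve-∀ ℚ-ring
  factor : ∀ y n → y + n * y ≡ (1ℚ + n) * y
  factor = solve-∀ ℚ-ring
  split : Σℕ (suc N) (λ t → ℕ→ℚ (suc t) * a t k * invℕ (N ℕ.∸ t)) ≡ X + Y
  split = trans (Σℕ-cong (suc N) (λ t _ → trans (cong (λ z → z * a t k * invℕ (N ℕ.∸ t)) (trans (ℕ→ℚ-suc t) (ℚP.+-comm 1ℚ (ℕ→ℚ t))))
            (expand (ℕ→ℚ t) (a t k) (invℕ (N ℕ.∸ t)))))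
          (Σ-+ (suc N) (λ t → ℕ→ℚ (toℕ t) * a (toℕ t) k * invℕ (N ℕ.∸ toℕ t)) (λ t → a (toℕ t) k * invℕ (N ℕ.∸ toℕ t)))
    where
    expand : ∀ n x h → (n + 1ℚ) * x * h ≡ n * x * h + x * h
    expand = solve-∀ ℚ-ring

conv≡derivative : ∀ N k → conv N k ≡ ℕ→ℚ (suc k) * a N (suc k)
convShift≡k*a : ∀ N k → convShift N k ≡ ℕ→ℚ k * a N k

conv≡derivative zero k = trans (zero-sum (a 0 k)) (sym (trans (cong (ℕ→ℚ (suc k) *_) (a-vanishing 0 (suc k) (s≤s z≤n))) (*-zeroʳ (ℕ→ℚ (suc k)))))
  where
  zero-sum : ∀ x → x * 0ℚ + 0ℚ ≡ 0ℚ
  zero-sum = solve-∀ ℚ-ring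
conv≡derivative (suc N) k = *-cancelˡ-≢0 (ℕ→ℚ (suc N)) _ _ (ℕ→ℚ-suc≢0 N) (begin
    ℕ→ℚ (suc N) * conv (suc N) k
      ≡⟨ conv-recurrence N k ⟩
    ℕ→ℚ (suc N) * conv N k + convShift N k + a N k
      ≡⟨ cong₂ (λ x y → ℕ→ℚ (suc N) * x + y + a N k) (conv≡derivative N k) (convShift≡k*a N k) ⟩
    ℕ→ℚ (suc N) * (ℕ→ℚ (suc k) * a N (suc k)) + ℕ→ℚ k * a N k + a N k
      ≡⟨ cong (λ z → ℕ→ℚ (suc N) * (z * a N (suc k)) + ℕ→ℚ k * a N k + a N k) (ℕ→ℚ-suc k) ⟩
    ℕ→ℚ (suc N) * ((1ℚ + ℕ→ℚ k) * a N (suc k)) + ℕ→ℚ k * a N k + a N k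
      ≡⟨ cancel-suc (ℕ→ℚ (suc N)) (ℕ→ℚ k) (a N (suc k)) (a N k) (inv (ℕ→ℚ (suc N))) (invℕ-inverse N) ⟩
    ℕ→ℚ (suc N) * ((1ℚ + ℕ→ℚ k) * (a N (suc k) + a N k * inv (ℕ→ℚ (suc N))))
      ≡⟨ cong₂ (λ x y → ℕ→ℚ (suc N) * (x * y)) (sym (ℕ→ℚ-suc k)) (sym (a-suc N (suc k))) ⟩
    ℕ→ℚ (suc N) * (ℕ→ℚ (suc k) * a (suc N) (suc k)) ∎)
  where
  open ≡-Reasoning
  cancel-suc : ∀ n k x y i → n * i ≡ 1ℚ → n * ((1ℚ + k) * x) + k * y + y ≡ n * ((1ℚ + k) * (x + y * i))
  cancel-suc n k x y i e = trans (regroup n k x y) (trans (cong (λ z → n * ((1ℚ + k) * x) + (1ℚ + k) * y * z) (sym e)) (factor n k x y i))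
    where
    regroup : ∀ n k x y → n * ((1ℚ + k) * x) + k * y + y ≡ n * ((1ℚ + k) * x) + (1ℚ + k) * y * 1ℚ
    regroup = solve-∀ ℚ-ring
    factor : ∀ n k x y i → n * ((1ℚ + k) * x) + (1ℚ + k) * y * (n * i) ≡ n * ((1ℚ + k) * (x + y * i))
    factor = solve-∀ ℚ-ring

convShift≡k*a N zero = sym (*-zeroˡ (a N 0))
convShift≡k*a N (suc k) = conv≡derivative N k

-- Writing (s - 1)/(s + k - 1) = 1 - k/(s + k - 1) splits (s - 1) F n into Σ_k a n k B_k = 1/(n + 1)
-- and a sum of k a n k B_k/(s + k - 1), which conv≡derivative expresses through the differences ΔF t.
module Convolution (m : ℕ) (s : ℚ) (hs : ∀ j → j ℕ.≤ m → s + ℕ→ℚ j - 1ℚ ≢ 0ℚ) where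
  K : ℕ
  K = suc m

  pole : ℕ → ℚ
  pole k = inv (s + ℕ→ℚ k - 1ℚ)

  pole-shift : ∀ k → k ℕ.≤ m → (s - 1ℚ) * pole k ≡ 1ℚ - ℕ→ℚ k * pole k
  pole-shift k h = trans (split-pole s (ℕ→ℚ k) (pole k)) (cong (_- ℕ→ℚ k * pole k) (inv-inverseʳ _ (hs k h)))
    where
    split-pole : ∀ s k e → (s - 1ℚ) * e ≡ (s + k - 1ℚ) * e - k * e
    split-pole = solve-∀ ℚ-ring

  Fpad : ℕ → ℚ
  Fpad n = Σℕ K (λ k → a n k * B k * pole k)

  F≡Fpad : ∀ n → n ℕ.≤ m → F n s ≡ Fpad n
  F≡Fpad n h = sym (Σℕ-truncate (suc n) K (λ k → a n k * B k * pole k) (s≤s h)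
    (λ i i>n → trans (cong (λ z → z * B i * pole i) (a-vanishing n i i>n)) (zero-left (B i) (pole i))))
    where
    zero-left : ∀ x y → 0ℚ * x * y ≡ 0ℚ
    zero-left = solve-∀ ℚ-ring

  ΔF : ℕ → ℚ
  ΔF t = F t s - F (suc t) s

  G : ℕ → ℚ
  G t = Σℕ K (λ k → aShift t k * B k * pole k)

  ΔF-formula : ∀ t → suc t ℕ.≤ m → ℕ→ℚ (suc t) * ΔF t ≡ - G t
  ΔF-formula t h = begin
      ℕ→ℚ (suc t) * (F t s - F (suc t) s)
        ≡⟨ cong₂ (λ x y → ℕ→ℚ (suc t) * (x - y)) (F≡Fpad t (ℕP.<⇒≤ h)) (F≡Fpad (suc t) h) ⟩
      ℕ→ℚ (suc t) * (Fpad t - Fpad (suc t))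
        ≡⟨ cong (ℕ→ℚ (suc t) *_) (Σℕ-sub K (λ k → a t k * B k * pole k) (λ k → a (suc t) k * B k * pole k)) ⟩
      ℕ→ℚ (suc t) * Σℕ K (λ k → a t k * B k * pole k - a (suc t) k * B k * pole k)
        ≡⟨ Σ-*ˡ K (ℕ→ℚ (suc t)) (λ k → a t (toℕ k) * B (toℕ k) * pole (toℕ k) - a (suc t) (toℕ k) * B (toℕ k) * pole (toℕ k)) ⟩
      Σℕ K (λ k → ℕ→ℚ (suc t) * (a t k * B k * pole k - a (suc t) k * B k * pole k))
        ≡⟨ Σℕ-cong K (λ k _ → trans (cong (λ z → ℕ→ℚ (suc t) * (a t k * B k * pole k - z * B k * pole k)) (a-suc t k))
              (cancel-suc (ℕ→ℚ (suc t)) (a t k) (aShift t k) (inv (ℕ→ℚ (suc t))) (B k) (pole k) (invℕ-inverse t))) ⟩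
      Σℕ K (λ k → - (aShift t k * B k * pole k))
        ≡⟨ sym (Σ-neg K (λ k → aShift t (toℕ k) * B (toℕ k) * pole (toℕ k))) ⟩
      - G t ∎
    where
    open ≡-Reasoning
    cancel-suc : ∀ n x p i b c → n * i ≡ 1ℚ → n * (x * b * c - (x + p * i) * b * c) ≡ - (p * b * c)
    cancel-suc n x p i b c eq = trans (regroup n x p i b c) (trans (cong (λ z → - (z * p * b * c)) eq) (unit p b c))
      where
      regroup : ∀ n x p i b c → n * (x * b * c - (x + p * i) * b * c) ≡ - ((n * i) * p * b * c)
      regroup = solve-∀ ℚ-ring
      unit : ∀ p b c → - (1ℚ * p * b * c) ≡ - (p * b * c)
      unit = solve-∀ ℚ-ring

  convolution-identity : ∀ n → n ℕ.≤ m →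
    (s - 1ℚ) * F n s ≡ inv (ℕ→ℚ (suc n)) + Σℕ n (λ t → ℕ→ℚ (suc t) * ΔF t * invℕ (n ℕ.∸ t))
  convolution-identity n h = begin
      (s - 1ℚ) * F n s
        ≡⟨ cong ((s - 1ℚ) *_) (F≡Fpad n h) ⟩
      (s - 1ℚ) * Fpad n
        ≡⟨ Σ-*ˡ K (s - 1ℚ) (λ k → a n (toℕ k) * B (toℕ k) * pole (toℕ k)) ⟩
      Σℕ K (λ k → (s - 1ℚ) * (a n k * B k * pole k))
        ≡⟨ Σℕ-cong K (λ k k<K → trans (move-scalar (s - 1ℚ) (a n k) (B k) (pole k)) (trans (cong (a n k * B k *_) (pole-shift k (ℕP.≤-pred k<K)))
              (expand (a n k) (B k) (ℕ→ℚ k) (pole k)))) ⟩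
      Σℕ K (λ k → a n k * B k - B k * pole k * (ℕ→ℚ k * a n k))
        ≡⟨ sym (Σℕ-sub K (λ k → a n k * B k) (λ k → B k * pole k * (ℕ→ℚ k * a n k))) ⟩
      Σℕ K (λ k → a n k * B k) - Σℕ K (λ k → B k * pole k * (ℕ→ℚ k * a n k))
        ≡⟨ cong₂ _-_ (Σ-a-B n K (s≤s h)) (sym Σ-G-conv) ⟩
      inv (ℕ→ℚ (suc n)) - Σℕ n (λ t → G t * invℕ (n ℕ.∸ t))
        ≡⟨ cong (inv (ℕ→ℚ (suc n)) +_) (trans (Σ-neg n (λ t → G (toℕ t) * invℕ (n ℕ.∸ toℕ t)))
              (Σℕ-cong n (λ t t<n → trans (neg-left (G t) (invℕ (n ℕ.∸ t))) (cong (_* invℕ (n ℕ.∸ t)) (sym (ΔF-formula t (ℕP.≤-trans t<n h))))))) ⟩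
      inv (ℕ→ℚ (suc n)) + Σℕ n (λ t → ℕ→ℚ (suc t) * ΔF t * invℕ (n ℕ.∸ t)) ∎
    where
    open ≡-Reasoning
    move-scalar : ∀ c x b e → c * (x * b * e) ≡ x * b * (c * e)
    move-scalar = solve-∀ ℚ-ring
    expand : ∀ x b k e → x * b * (1ℚ - k * e) ≡ x * b - b * e * (k * x)
    expand = solve-∀ ℚ-ring
    neg-left : ∀ g h → - (g * h) ≡ - g * h
    neg-left = solve-∀ ℚ-ring
    Σ-aShift-invℕ : ∀ k → Σℕ n (λ t → aShift t k * invℕ (n ℕ.∸ t)) ≡ ℕ→ℚ k * a n k
    Σ-aShift-invℕ k = trans (sym (Σℕ-dropLast n (λ t → aShift t k * invℕ (n ℕ.∸ t)) (trans (cong (λ z → aShift n k * invℕ z) (ℕP.n∸n≡0 n)) (*-zeroʳ (aShift n k)))))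
       (trans (Σ-aShift-conv n k) (convShift≡k*a n k))
    Σ-G-conv : Σℕ n (λ t → G t * invℕ (n ℕ.∸ t)) ≡ Σℕ K (λ k → B k * pole k * (ℕ→ℚ k * a n k))
    Σ-G-conv = begin
        Σℕ n (λ t → G t * invℕ (n ℕ.∸ t))
          ≡⟨ Σℕ-cong n (λ t _ → trans (Σ-*ʳ K (invℕ (n ℕ.∸ t)) (λ k → aShift t (toℕ k) * B (toℕ k) * pole (toℕ k)))
               (Σℕ-cong K (λ k _ → regroup (aShift t k) (B k) (pole k) (invℕ (n ℕ.∸ t))))) ⟩
        Σℕ n (λ t → Σℕ K (λ k → B k * pole k * (aShift t k * invℕ (n ℕ.∸ t))))
          ≡⟨ Σ-swap n K (λ t k → B (toℕ k) * pole (toℕ k) * (aShift (toℕ t) (toℕ k) * invℕ (n ℕ.∸ toℕ t))) ⟩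
        Σℕ K (λ k → Σℕ n (λ t → B k * pole k * (aShift t k * invℕ (n ℕ.∸ t))))
          ≡⟨ Σℕ-cong K (λ k _ → trans (sym (Σ-*ˡ n (B k * pole k) (λ t → aShift (toℕ t) k * invℕ (n ℕ.∸ toℕ t))))
               (cong (B k * pole k *_) (Σ-aShift-invℕ k))) ⟩
        Σℕ K (λ k → B k * pole k * (ℕ→ℚ k * a n k)) ∎
      where
      regroup : ∀ p b e h → p * b * e * h ≡ b * e * (p * h)
      regroup = solve-∀ ℚ-ring

-- The linear system

T-below : ∀ m (i k : Fin m) → toℕ k ℕ.< toℕ i →
  T m i k ≡ - (ℕ→ℚ (idx k) * inv (ℕ→ℚ ((idx i ℕ.∸ idx k) ℕ.* (idx i ℕ.∸ idx k ℕ.+ 1))))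
T-below m i k lt with idx k ℕ.<? idx i | idx i ℕ.≟ idx k
... | yes _ | _ = refl
... | no p | _ = ⊥-elim (p (s≤s lt))

T-diagonal : ∀ m (i : Fin m) → T m i i ≡ ℕ→ℚ (idx i)
T-diagonal m i with idx i ℕ.<? idx i | idx i ℕ.≟ idx i
... | yes p | _ = ⊥-elim (ℕP.<-irrefl refl p)
... | no _ | yes _ = refl
... | no _ | no q = ⊥-elim (q refl)

T-above : ∀ m (i k : Fin m) → toℕ i ℕ.< toℕ k → T m i k ≡ 0ℚ
T-above m i k gt with idx k ℕ.<? idx i | idx i ℕ.≟ idx k
... | yes p | _ = ⊥-elim (ℕP.<-asym gt (ℕP.≤-pred p))
... | no _ | yes e = ⊥-elim (ℕP.<-irrefl (ℕP.suc-injective e) gt)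
... | no _ | no _ = refl

I-diagonal : ∀ m (i : Fin m) → I m i i ≡ 1ℚ
I-diagonal m i with i Fin.≟ i
... | yes _ = refl
... | no q = ⊥-elim (q refl)

I-offDiagonal : ∀ m (i k : Fin m) → i ≢ k → I m i k ≡ 0ℚ
I-offDiagonal m i k ne with i Fin.≟ k
... | yes e = ⊥-elim (ne e)
... | no _ = refl

module LinearSystem (m : ℕ) (s : ℚ) (hs : ∀ j → j ℕ.≤ m → s + ℕ→ℚ j - 1ℚ ≢ 0ℚ) where
  open Convolution m s hs

  weight : ℕ → ℕ → ℚ
  weight it t = ℕ→ℚ (suc t) * inv (ℕ→ℚ ((it ℕ.∸ t) ℕ.* (it ℕ.∸ t ℕ.+ 1)))

  rowTerm : ℕ → ℕ → ℚ
  rowTerm it k with k ℕ.<? it | k ℕ.≟ it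
  ... | yes _ | _ = - weight it k * ΔF k
  ... | no _ | yes _ = (ℕ→ℚ (suc k) + (s - 1ℚ)) * ΔF k
  ... | no _ | no _ = 0ℚ

  rowTerm-below : ∀ it k → k ℕ.< it → rowTerm it k ≡ - weight it k * ΔF k
  rowTerm-below it k lt with k ℕ.<? it | k ℕ.≟ it
  ... | yes _ | _ = refl
  ... | no p | _ = ⊥-elim (p lt)

  rowTerm-diagonal : ∀ it → rowTerm it it ≡ (ℕ→ℚ (suc it) + (s - 1ℚ)) * ΔF it
  rowTerm-diagonal it with it ℕ.<? it | it ℕ.≟ it
  ... | yes p | _ = ⊥-elim (ℕP.<-irrefl refl p)
  ... | no _ | yes _ = refl
  ... | no _ | no q = ⊥-elim (q refl)

  rowTerm-above : ∀ it k → it ℕ.< k → rowTerm it k ≡ 0ℚ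
  rowTerm-above it k gt with k ℕ.<? it | k ℕ.≟ it
  ... | yes p | _ = ⊥-elim (ℕP.<-asym gt p)
  ... | no _ | yes e = ⊥-elim (ℕP.<-irrefl (sym e) gt)
  ... | no _ | no _ = refl

  A : Fin m → Fin m → ℚ
  A i k = T m i k + (s - 1ℚ) * I m i k

  A-row : ∀ (i k : Fin m) → A i k * ΔF (toℕ k) ≡ rowTerm (toℕ i) (toℕ k)
  A-row i k with ℕP.<-cmp (toℕ k) (toℕ i)
  ... | tri< lt _ _ = trans (cong₂ (λ x y → (x + (s - 1ℚ) * y) * ΔF (toℕ k)) (T-below m i k lt)
                         (I-offDiagonal m i k (λ e → ℕP.<-irrefl (cong toℕ (sym e)) lt)))
                      (trans (zero-diagonal (weight (toℕ i) (toℕ k)) (s - 1ℚ) (ΔF (toℕ k))) (sym (rowTerm-below (toℕ i) (toℕ k) lt)))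
    where
    zero-diagonal : ∀ c t x → (- c + t * 0ℚ) * x ≡ - c * x
    zero-diagonal = solve-∀ ℚ-ring
  ... | tri≈ _ e _ = onDiagonal (FinP.toℕ-injective e)
    where
    onDiagonal : k ≡ i → A i k * ΔF (toℕ k) ≡ rowTerm (toℕ i) (toℕ k)
    onDiagonal refl = trans (cong₂ (λ x y → (x + (s - 1ℚ) * y) * ΔF (toℕ k)) (T-diagonal m k) (I-diagonal m k))
               (trans (cong (λ z → (ℕ→ℚ (idx k) + z) * ΔF (toℕ k)) (*-identityʳ (s - 1ℚ))) (sym (rowTerm-diagonal (toℕ k))))
  ... | tri> _ _ gt = trans (cong₂ (λ x y → (x + (s - 1ℚ) * y) * ΔF (toℕ k)) (T-above m i k gt)
                         (I-offDiagonal m i k (λ e → ℕP.<-irrefl (cong toℕ e) gt)))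
                      (trans (zero-entry (s - 1ℚ) (ΔF (toℕ k))) (sym (rowTerm-above (toℕ i) (toℕ k) gt)))
    where
    zero-entry : ∀ t x → (0ℚ + t * 0ℚ) * x ≡ 0ℚ
    zero-entry = solve-∀ ℚ-ring

  ΔF-recurrence : ∀ it → suc it ℕ.≤ m →
    (ℕ→ℚ (suc it) + (s - 1ℚ)) * ΔF it ≡
      inv (ℕ→ℚ (suc it ℕ.* (suc it ℕ.+ 1))) + Σℕ it (λ t → weight it t * ΔF t)
  ΔF-recurrence it h = begin
      (ℕ→ℚ (suc it) + (s - 1ℚ)) * ΔF it
        ≡⟨ distribute (ℕ→ℚ (suc it)) (s - 1ℚ) (F it s) (F (suc it) s) ⟩
      ℕ→ℚ (suc it) * ΔF it + ((s - 1ℚ) * F it s - (s - 1ℚ) * F (suc it) s)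
        ≡⟨ cong₂ (λ x y → ℕ→ℚ (suc it) * ΔF it + (x - y)) (convolution-identity it (ℕP.<⇒≤ h)) (convolution-identity (suc it) h) ⟩
      ℕ→ℚ (suc it) * ΔF it + ((inv (ℕ→ℚ (suc it)) + S0) - (inv (ℕ→ℚ (suc (suc it))) + Σℕ (suc it) g1))
        ≡⟨ cong (λ z → ℕ→ℚ (suc it) * ΔF it + ((inv (ℕ→ℚ (suc it)) + S0) - (inv (ℕ→ℚ (suc (suc it))) + z))) (Σℕ-last it g1) ⟩
      ℕ→ℚ (suc it) * ΔF it + ((inv (ℕ→ℚ (suc it)) + S0) - (inv (ℕ→ℚ (suc (suc it))) + (Σℕ it g1 + g1 it)))
        ≡⟨ cong (λ z → ℕ→ℚ (suc it) * ΔF it + ((inv (ℕ→ℚ (suc it)) + S0) - (inv (ℕ→ℚ (suc (suc it))) + (Σℕ it g1 + z)))) g1-last ⟩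
      ℕ→ℚ (suc it) * ΔF it + ((inv (ℕ→ℚ (suc it)) + S0) - (inv (ℕ→ℚ (suc (suc it))) + (Σℕ it g1 + ℕ→ℚ (suc it) * ΔF it)))
        ≡⟨ rearrange (ℕ→ℚ (suc it) * ΔF it) (inv (ℕ→ℚ (suc it))) (inv (ℕ→ℚ (suc (suc it)))) S0 (Σℕ it g1) ⟩
      (inv (ℕ→ℚ (suc it)) - inv (ℕ→ℚ (suc (suc it)))) + (S0 - Σℕ it g1)
        ≡⟨ cong₂ _+_ (inv-partialFraction it) (trans (Σℕ-sub it g0 g1) (Σℕ-cong it (λ t t<it → diff t t<it))) ⟩
      inv (ℕ→ℚ (suc it ℕ.* (suc it ℕ.+ 1))) + Σℕ it (λ t → weight it t * ΔF t) ∎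
    where
    open ≡-Reasoning
    g0 = λ t → ℕ→ℚ (suc t) * ΔF t * invℕ (it ℕ.∸ t)
    g1 = λ t → ℕ→ℚ (suc t) * ΔF t * invℕ (suc it ℕ.∸ t)
    S0 = Σℕ it g0
    distribute : ∀ n c f0 f1 → (n + c) * (f0 - f1) ≡ n * (f0 - f1) + (c * f0 - c * f1)
    distribute = solve-∀ ℚ-ring
    rearrange : ∀ y i0 i1 s0 s1 → y + ((i0 + s0) - (i1 + (s1 + y))) ≡ (i0 - i1) + (s0 - s1)
    rearrange = solve-∀ ℚ-ring
    g1-last : g1 it ≡ ℕ→ℚ (suc it) * ΔF it
    g1-last = trans (cong (λ z → ℕ→ℚ (suc it) * ΔF it * invℕ z) (trans (ℕP.+-∸-assoc 1 (ℕP.≤-refl {it})) (cong suc (ℕP.n∸n≡0 it))))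
                (*-identityʳ _)
    diff : ∀ t → t ℕ.< it → g0 t - g1 t ≡ weight it t * ΔF t
    diff t t<it = begin
        ℕ→ℚ (suc t) * ΔF t * invℕ (it ℕ.∸ t) - ℕ→ℚ (suc t) * ΔF t * invℕ (suc it ℕ.∸ t)
          ≡⟨ factor (ℕ→ℚ (suc t) * ΔF t) (invℕ (it ℕ.∸ t)) (invℕ (suc it ℕ.∸ t)) ⟩
        ℕ→ℚ (suc t) * ΔF t * (invℕ (it ℕ.∸ t) - invℕ (suc it ℕ.∸ t))
          ≡⟨ cong (ℕ→ℚ (suc t) * ΔF t *_) (invℕ-∸-difference it t t<it) ⟩
        ℕ→ℚ (suc t) * ΔF t * inv (ℕ→ℚ ((it ℕ.∸ t) ℕ.* (it ℕ.∸ t ℕ.+ 1)))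
          ≡⟨ swap (ℕ→ℚ (suc t)) (ΔF t) _ ⟩
        weight it t * ΔF t ∎
      where
      factor : ∀ a x y → a * x - a * y ≡ a * (x - y)
      factor = solve-∀ ℚ-ring
      swap : ∀ n x i → n * x * i ≡ n * i * x
      swap = solve-∀ ℚ-ring

  𝐮 : Fin m → ℚ
  𝐮 i = inv (ℕ→ℚ (idx i ℕ.* (idx i ℕ.+ 1)))

  𝐯 : Fin m → ℚ
  𝐯 j = ℕ→ℚ ((m ℕ.+ 1) ℕ.* idx j) * inv (ℕ→ℚ (m ℕ.∸ idx j ℕ.+ 1))

  𝐱 : Fin m → ℚ
  𝐱 k = ΔF (toℕ k)

  A·x≡u : ∀ (i : Fin m) → Σ m (λ k → A i k * 𝐱 k) ≡ 𝐮 i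
  A·x≡u i = begin
      Σ m (λ k → A i k * 𝐱 k)
        ≡⟨ Σ-cong m (A-row i) ⟩
      Σℕ m (rowTerm it)
        ≡⟨ Σℕ-truncate (suc it) m (rowTerm it) (FinP.toℕ<n i) (λ k gt → rowTerm-above it k gt) ⟩
      Σℕ (suc it) (rowTerm it)
        ≡⟨ Σℕ-last it (rowTerm it) ⟩
      Σℕ it (rowTerm it) + rowTerm it it
        ≡⟨ cong₂ _+_ (Σℕ-cong it (λ t t<it → rowTerm-below it t t<it)) (rowTerm-diagonal it) ⟩
      Σℕ it (λ t → - weight it t * ΔF t) + (ℕ→ℚ (suc it) + (s - 1ℚ)) * ΔF it
        ≡⟨ cong₂ _+_ (trans (Σℕ-cong it (λ t _ → neg-left (weight it t) (ΔF t))) (sym (Σ-neg it (λ t → weight it (toℕ t) * ΔF (toℕ t)))))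
              (ΔF-recurrence it (FinP.toℕ<n i)) ⟩
      - Σℕ it (λ t → weight it t * ΔF t) + (𝐮 i + Σℕ it (λ t → weight it t * ΔF t))
        ≡⟨ cancel (Σℕ it (λ t → weight it t * ΔF t)) (𝐮 i) ⟩
      𝐮 i ∎
    where
    open ≡-Reasoning
    it = toℕ i
    neg-left : ∀ c x → - c * x ≡ - (c * x)
    neg-left = solve-∀ ℚ-ring
    cancel : ∀ a u → - a + (u + a) ≡ u
    cancel = solve-∀ ℚ-ring

  1+v·x : 1ℚ + Σ m (λ k → 𝐯 k * 𝐱 k) ≡ ℕ→ℚ (suc m) * ((s - 1ℚ) * F m s)
  1+v·x = sym (begin
      ℕ→ℚ (suc m) * ((s - 1ℚ) * F m s)
        ≡⟨ cong (ℕ→ℚ (suc m) *_) (convolution-identity m ℕP.≤-refl) ⟩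
      ℕ→ℚ (suc m) * (inv (ℕ→ℚ (suc m)) + Σℕ m (λ t → ℕ→ℚ (suc t) * ΔF t * invℕ (m ℕ.∸ t)))
        ≡⟨ ℚP.*-distribˡ-+ (ℕ→ℚ (suc m)) _ _ ⟩
      ℕ→ℚ (suc m) * inv (ℕ→ℚ (suc m)) + ℕ→ℚ (suc m) * Σℕ m (λ t → ℕ→ℚ (suc t) * ΔF t * invℕ (m ℕ.∸ t))
        ≡⟨ cong₂ _+_ (inv-inverseʳ _ (ℕ→ℚ-suc≢0 m)) (Σ-*ˡ m (ℕ→ℚ (suc m)) (λ t → ℕ→ℚ (suc (toℕ t)) * ΔF (toℕ t) * invℕ (m ℕ.∸ toℕ t))) ⟩
      1ℚ + Σℕ m (λ t → ℕ→ℚ (suc m) * (ℕ→ℚ (suc t) * ΔF t * invℕ (m ℕ.∸ t)))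
        ≡⟨ cong (1ℚ +_) (Σ-cong m (λ k → sym (term k))) ⟩
      1ℚ + Σ m (λ k → 𝐯 k * 𝐱 k) ∎)
    where
    open ≡-Reasoning
    term : ∀ (k : Fin m) → 𝐯 k * 𝐱 k ≡ ℕ→ℚ (suc m) * (ℕ→ℚ (suc (toℕ k)) * ΔF (toℕ k) * invℕ (m ℕ.∸ toℕ k))
    term k = begin
        ℕ→ℚ ((m ℕ.+ 1) ℕ.* suc t) * inv (ℕ→ℚ (m ℕ.∸ suc t ℕ.+ 1)) * ΔF t
          ≡⟨ cong₂ (λ x y → ℕ→ℚ (x ℕ.* suc t) * inv (ℕ→ℚ y) * ΔF t) (ℕP.+-comm m 1) e2 ⟩
        ℕ→ℚ (suc m ℕ.* suc t) * invℕ (m ℕ.∸ t) * ΔF t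
          ≡⟨ cong (λ z → z * invℕ (m ℕ.∸ t) * ΔF t) (ℕ→ℚ-* (suc m) (suc t)) ⟩
        ℕ→ℚ (suc m) * ℕ→ℚ (suc t) * invℕ (m ℕ.∸ t) * ΔF t
          ≡⟨ regroup (ℕ→ℚ (suc m)) (ℕ→ℚ (suc t)) (invℕ (m ℕ.∸ t)) (ΔF t) ⟩
        ℕ→ℚ (suc m) * (ℕ→ℚ (suc t) * ΔF t * invℕ (m ℕ.∸ t)) ∎
      where
      t = toℕ k
      e2 : m ℕ.∸ suc t ℕ.+ 1 ≡ m ℕ.∸ t
      e2 = trans (ℕP.+-comm (m ℕ.∸ suc t) 1) (sym (ℕP.+-∸-assoc 1 (FinP.toℕ<n k)))
      regroup : ∀ a b h x → a * b * h * x ≡ a * (b * x * h)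
      regroup = solve-∀ ℚ-ring

  A-lowerTriangular : LowerTriangular m A
  A-lowerTriangular i j lt = trans (cong₂ (λ x y → x + (s - 1ℚ) * y) (T-above m i j lt) (I-offDiagonal m i j (λ e → ℕP.<-irrefl (cong toℕ e) lt)))
    (zero-entry (s - 1ℚ))
    where
    zero-entry : ∀ c → 0ℚ + c * 0ℚ ≡ 0ℚ
    zero-entry = solve-∀ ℚ-ring

  A-diagonal : ∀ i → A i i ≡ s + ℕ→ℚ (suc (toℕ i)) - 1ℚ
  A-diagonal i = trans (cong₂ (λ x y → x + (s - 1ℚ) * y) (T-diagonal m i) (I-diagonal m i)) (rearrange (ℕ→ℚ (suc (toℕ i))) s)
    where
    rearrange : ∀ n s → n + (s - 1ℚ) * 1ℚ ≡ s + n - 1ℚ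
    rearrange = solve-∀ ℚ-ring

  A-diagonal≢0 : ∀ i → A i i ≢ 0ℚ
  A-diagonal≢0 i e = hs (suc (toℕ i)) (FinP.toℕ<n i) (trans (sym (A-diagonal i)) e)

  R≡u⊗v : ∀ i j → R m i j ≡ 𝐮 i * 𝐯 j
  R≡u⊗v i j = begin
      ℕ→ℚ ((m ℕ.+ 1) ℕ.* idx j) * inv (ℕ→ℚ (idx i ℕ.* (idx i ℕ.+ 1) ℕ.* (m ℕ.∸ idx j ℕ.+ 1)))
        ≡⟨ cong (λ z → ℕ→ℚ ((m ℕ.+ 1) ℕ.* idx j) * inv z) (ℕ→ℚ-* (idx i ℕ.* (idx i ℕ.+ 1)) (m ℕ.∸ idx j ℕ.+ 1)) ⟩
      ℕ→ℚ ((m ℕ.+ 1) ℕ.* idx j) * inv (ℕ→ℚ (idx i ℕ.* (idx i ℕ.+ 1)) * ℕ→ℚ (m ℕ.∸ idx j ℕ.+ 1))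
        ≡⟨ cong (ℕ→ℚ ((m ℕ.+ 1) ℕ.* idx j) *_) (inv-* (ℕ→ℚ (idx i ℕ.* (idx i ℕ.+ 1))) (ℕ→ℚ (m ℕ.∸ idx j ℕ.+ 1))) ⟩
      ℕ→ℚ ((m ℕ.+ 1) ℕ.* idx j) * (𝐮 i * inv (ℕ→ℚ (m ℕ.∸ idx j ℕ.+ 1)))
        ≡⟨ regroup (ℕ→ℚ ((m ℕ.+ 1) ℕ.* idx j)) (𝐮 i) (inv (ℕ→ℚ (m ℕ.∸ idx j ℕ.+ 1))) ⟩
      𝐮 i * 𝐯 j ∎
    where
    open ≡-Reasoning
    regroup : ∀ p u q → p * (u * q) ≡ u * (p * q)
    regroup = solve-∀ ℚ-ring

  M : Matrix m
  M i j = T m i j + R m i j + (s - 1ℚ) * I m i j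

  det-M : det m M ≡ Π m (λ i → A i i) * (ℕ→ℚ (suc m) * ((s - 1ℚ) * F m s))
  det-M = begin
      det m M
        ≡⟨ det-cong m (λ i j → trans (cong (λ r → T m i j + r + (s - 1ℚ) * I m i j) (R≡u⊗v i j))
             (+-rightComm (T m i j) (𝐮 i * 𝐯 j) ((s - 1ℚ) * I m i j))) ⟩
      det m (λ i j → A i j + 𝐮 i * 𝐯 j)
        ≡⟨ det-rankOneUpdate m A A-lowerTriangular A-diagonal≢0 𝐮 𝐯 𝐱 A·x≡u ⟩
      det m A * (1ℚ + Σ m (λ k → 𝐯 k * 𝐱 k))
        ≡⟨ cong₂ _*_ (det-lowerTriangular m A A-lowerTriangular) 1+v·x ⟩
      Π m (λ i → A i i) * (ℕ→ℚ (suc m) * ((s - 1ℚ) * F m s)) ∎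
    where
    open ≡-Reasoning
    +-rightComm : ∀ x y z → x + y + z ≡ x + z + y
    +-rightComm = solve-∀ ℚ-ring

  pole-zero : s + ℕ→ℚ 0 - 1ℚ ≡ s - 1ℚ
  pole-zero = +0-1 s
    where
    +0-1 : ∀ x → x + 0ℚ - 1ℚ ≡ x - 1ℚ
    +0-1 = solve-∀ ℚ-ring

  Π-poles : Π (suc m) (λ j → s + ℕ→ℚ (toℕ j) - 1ℚ) ≡ (s - 1ℚ) * Π m (λ i → A i i)
  Π-poles = cong₂ _*_ pole-zero (Π-cong m (λ i → sym (A-diagonal i)))

  s-1≢0 : s - 1ℚ ≢ 0ℚ
  s-1≢0 s-1≡0 = hs 0 z≤n (trans pole-zero s-1≡0)

  ΠA≢0 : Π m (λ i → A i i) ≢ 0ℚ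
  ΠA≢0 = Π-≢0 m (λ i → A i i) A-diagonal≢0

mainTheorem11 : (m : ℕ) → 1 ≤ m → (s : ℚ) →
    ((j : ℕ) → j ≤ m → s + ℕ→ℚ j - 1ℚ ≢ 0ℚ) →
    F m s ≡ inv (ℕ→ℚ (m Data.Nat.+ 1)) *
    det m (λ i j → T m i j + R m i j + (s - 1ℚ) * I m i j) *
    inv (Π (Data.Nat.suc m) (λ j → s + ℕ→ℚ (toℕ j) - 1ℚ))
mainTheorem11 m _ s hs = sym (begin
    inv (ℕ→ℚ (m ℕ.+ 1)) * det m M * inv (Π (suc m) (λ j → s + ℕ→ℚ (toℕ j) - 1ℚ))
      ≡⟨ cong₂ (λ n p → inv n * det m M * inv p) (cong ℕ→ℚ (ℕP.+-comm m 1)) Π-poles ⟩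
    inv m+1 * det m M * inv ((s - 1ℚ) * ΠA)
      ≡⟨ cong₂ (λ d p → inv m+1 * d * p) det-M (inv-* (s - 1ℚ) ΠA) ⟩
    inv m+1 * (ΠA * (m+1 * ((s - 1ℚ) * F m s))) * (inv (s - 1ℚ) * inv ΠA)
      ≡⟨ inv-cancel₃ m+1 ΠA (s - 1ℚ) (F m s) (ℕ→ℚ-suc≢0 m) ΠA≢0 s-1≢0 ⟩
    F m s ∎)
  where
  open ≡-Reasoning
  open LinearSystem m s hs
  m+1 = ℕ→ℚ (suc m)
  ΠA = Π m (λ i → A i i)
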